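{- Let $v_1=v_1(z)$ be the unique root of $z u^3+(z^2-1)u^2-z^3u+z^2=0$ that is a formal Laurent series in $z$ of the form $v_1=\frac1z-z-z^5-2z^7-\cdots$. For $n\ge1$, let $c_n$ be the number of Dyck paths of semilength $n$ in which every descent other than the last one has odd length (the last descent may have odd or even length). Then $$\sum_{n\ge1}c_nz^{2n}=\frac{z v_1}{v_1^2-z^2}+\frac{z^2}{v_1^2-z^2},$$ and with $Z=z^2$ this equals $Z+2Z^2+4Z^3+9Z^4+22Z^5+56Z^6+147Z^7+\cdots$ (OEIS A143017).
   Context: A Dyck path is a nonempty finite sequence of up-steps $(1,1)$ and down-steps $(1,-1)$ starting at the origin, never going below the $x$-axis and ending on the $x$-axis. A descent is a maximal run of consecutive down-steps; its length is the number of down-steps in it. -}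

module Defs where

open import Data.Bool using (Bool; true; false; _∧_; not)
open import Data.Nat as ℕ using (ℕ; zero; suc)
open import Data.Integer as ℤ using (ℤ; +_; -[1+_])
open import Data.Rational using (ℚ; 0ℚ; 1ℚ; _+_; _*_; -_; _-_; _/_)
open import Data.List using (List; []; _∷_; map; _++_; length; filterᵇ)
open import Data.Product using (_×_)
open import Relation.Binary.PropositionalEquality using (_≡_)
open import Relation.Nullary using (¬_)

data Step : Set where
  U D : Step

validFrom : ℕ → List Step → Bool
validFrom zero    []      = true
validFrom (suc h) []      = false
validFrom h       (U ∷ s) = validFrom (suc h) s
validFrom zero    (D ∷ s) = false
validFrom (suc h) (D ∷ s) = validFrom h s

nonempty : List Step → Bool
nonempty []      = false
nonempty (_ ∷ _) = true

isDyck : List Step → Bool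
isDyck s = nonempty s ∧ validFrom 0 s

-- descentsAcc k s : lengths (in order) of the descents (maximal runs of
-- down-steps) of the word, where k down-steps are already pending.
descentsAcc : ℕ → List Step → List ℕ
descentsAcc zero    []      = []
descentsAcc (suc k) []      = suc k ∷ []
descentsAcc k       (D ∷ s) = descentsAcc (suc k) s
descentsAcc zero    (U ∷ s) = descentsAcc zero s
descentsAcc (suc k) (U ∷ s) = suc k ∷ descentsAcc zero s

descents : List Step → List ℕ
descents = descentsAcc zero

isOdd : ℕ → Bool
isOdd zero    = false
isOdd (suc n) = not (isOdd n)

allButLastOdd : List ℕ → Bool
allButLastOdd []           = true
allButLastOdd (x ∷ [])     = true
allButLastOdd (x ∷ y ∷ xs) = isOdd x ∧ allButLastOdd (y ∷ xs)

words : ℕ → List (List Step)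
words zero    = [] ∷ []
words (suc m) = map (U ∷_) (words m) ++ map (D ∷_) (words m)

c : ℕ → ℕ
c n = length (filterᵇ (λ s → isDyck s ∧ allButLastOdd (descents s))
                      (words (n ℕ.+ n)))

PS : Set
PS = ℕ → ℚ

sumQ : ℕ → (ℕ → ℚ) → ℚ
sumQ zero    f = 0ℚ
sumQ (suc n) f = sumQ n f + f n

mulPS : PS → PS → PS
mulPS f g n = sumQ (suc n) (λ i → f i * g (n ℕ.∸ i))

shiftPS : ℕ → PS → PS
shiftPS zero    f i       = f i
shiftPS (suc k) f zero    = 0ℚ
shiftPS (suc k) f (suc i) = shiftPS k f i

-- (k , f) represents the formal Laurent series  z^(-k) * Σ_i f i z^i
record Laurent : Set where
  constructor _⸴_
  field
    ord : ℕ
    cf  : PS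
open Laurent public

coeff : Laurent → ℤ → ℚ
coeff (k ⸴ f) m with m ℤ.+ + k
... | + i      = f i
... | -[1+ _ ] = 0ℚ

infix 4 _≈L_
_≈L_ : Laurent → Laurent → Set
A ≈L B = ∀ m → coeff A m ≡ coeff B m

infixl 6 _+L_ _-L_
infixl 7 _*L_

_+L_ : Laurent → Laurent → Laurent
(k ⸴ f) +L (l ⸴ g) = (k ℕ.+ l) ⸴ (λ i → shiftPS l f i + shiftPS k g i)

-L_ : Laurent → Laurent
-L (k ⸴ f) = k ⸴ (λ i → - f i)

_-L_ : Laurent → Laurent → Laurent
A -L B = A +L (-L B)

_*L_ : Laurent → Laurent → Laurent
(k ⸴ f) *L (l ⸴ g) = (k ℕ.+ l) ⸴ mulPS f g

zpow : ℕ → Laurent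
zpow n = 0 ⸴ shiftPS n (λ { zero → 1ℚ ; (suc _) → 0ℚ })

0L 1L zL : Laurent
0L = 0 ⸴ (λ _ → 0ℚ)
1L = zpow 0
zL = zpow 1

IsQuotient : Laurent → Laurent → Laurent → Set
IsQuotient Q A B = (¬ (B ≈L 0L)) × (Q *L B ≈L A)

cubic : Laurent → Laurent
cubic u = zL *L u *L u *L u +L (zpow 2 -L 1L) *L u *L u -L zpow 3 *L u +L zpow 2

ℕ→ℚ : ℕ → ℚ
ℕ→ℚ n = + n / 1

-- "v = 1/z - z - z^5 - 2 z^7 - ⋯": no terms below z^(-1), and the
-- coefficients of z^(-1), z^0, …, z^7 are 1,0,-1,0,0,0,-1,0,-2.
HasForm : Laurent → Set
HasForm v =
  (∀ n → coeff v (-[1+ suc n ]) ≡ 0ℚ) ×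
  coeff v (-[1+ 0 ]) ≡ 1ℚ × coeff v (+ 0) ≡ 0ℚ × coeff v (+ 1) ≡ - 1ℚ ×
  coeff v (+ 2) ≡ 0ℚ × coeff v (+ 3) ≡ 0ℚ × coeff v (+ 4) ≡ 0ℚ ×
  coeff v (+ 5) ≡ - 1ℚ × coeff v (+ 6) ≡ 0ℚ × coeff v (+ 7) ≡ - ℕ→ℚ 2

gfCoeff : ℕ → ℚ
gfCoeff i with isOdd i
... | true  = 0ℚ
... | false = ℕ→ℚ (c (i ℕ./ 2))

-- the generating function Σ_{n≥1} c_n z^(2n)   (note c 0 = 0)
GF : Laurent
GF = 0 ⸴ gfCoeff

-- A path in which every descent but the last is odd splits at its first return to the axis
-- into an arch followed by a shorter such path (possibly empty); the arch must then end with an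
-- odd descent. With x = z² marking an up/down pair, let O and E count these paths whose last
-- descent is odd, resp. even, and A and B the arches of either kind. An arch is U P D with P such a
-- path or empty, and the final D flips the parity of the last descent of P, so
--   O = A + A O,   E = B + A E,   A = x (1 + E),   B = x O.
-- Eliminating, w = 1 - A satisfies w³ + (x - 1) w² - x² w + x² = 0, the given cubic under
-- v₁ = w / z, and (O + E) (w - x) = x. A root of this cubic with constant term 1 is unique: the
-- difference of the cubic at two such roots u and w is (u - w) times a series with constant term 1.
-- Hence w = z v₁, which turns (O + E) (w - x) = x into the claimed quotient.

module Submission where

open import Defs
open import Algebra.Bundles using (CommutativeRing)
import Algebra.Solver.Ring
import Algebra.Solver.Ring.AlmostCommutativeRing as ACR
open import Data.Bool using (Bool; true; false; _∧_; _∨_; not; if_then_else_)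
import Data.Bool.Properties as BoolP
open import Data.Empty using (⊥; ⊥-elim)
open import Data.Integer as ℤ using (ℤ; -[1+_]; _⊖_)
import Data.Integer.Properties as ℤP
open import Data.List using (List; []; _∷_; _++_; foldl; length; map; filterᵇ)
import Data.List.Properties as ListP
open import Data.Maybe using (Maybe; just; nothing)
open import Data.Nat as ℕ using (ℕ; zero; suc; _<_; s≤s; z≤n)
import Data.Nat.Properties as ℕP
open import Data.Nat.Solver using (module +-*-Solver)
open import Data.Product using (∃₂; ∃-syntax; _×_; _,_)
open import Data.Rational as ℚ using (ℚ; 0ℚ; 1ℚ)
import Data.Rational.Properties as ℚP
import Data.Rational.Solver as ℚ-Solver
open import Data.Sum using (inj₁; inj₂)
open import Data.Unit using (⊤)
open import Function using (_∘_)
open import Level using (0ℓ)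
open import Relation.Binary.PropositionalEquality
  using (_≡_; refl; sym; trans; cong; cong₂; subst; module ≡-Reasoning)
open import Relation.Nullary using (¬_; yes; no)
open import Relation.Nullary.Decidable using (T?)

module FormalPowerSeries where

  open import Data.Rational using (_+_; _*_; -_)

  infix  4 _≐_
  infixl 6 _⊕_
  infixl 7 _⊛_
  infix  8 ⊝_

  _≐_ : PS → PS → Set
  f ≐ g = ∀ i → f i ≡ g i

  _⊕_ : PS → PS → PS
  (f ⊕ g) i = f i + g i

  ⊝_ : PS → PS
  (⊝ f) i = - f i

  tail : PS → PS
  tail f i = f (suc i)

  -- Recursive in the index, unlike mulPS, so that the ring laws follow by induction.
  _⊛_ : PS → PS → PS
  (f ⊛ g) zero    = f 0 * g 0
  (f ⊛ g) (suc n) = f 0 * g (suc n) + (tail f ⊛ g) n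

  const : ℚ → PS
  const q zero    = q
  const q (suc _) = 0ℚ

  0ₚ 1ₚ : PS
  0ₚ = λ _ → 0ℚ
  1ₚ = const 1ℚ

  module _ where
    open ℚ-Solver.+-*-Solver

    ⊛-cong : ∀ {f f′ g g′} → f ≐ f′ → g ≐ g′ → f ⊛ g ≐ f′ ⊛ g′
    ⊛-cong f≐f′ g≐g′ zero    = cong₂ _*_ (f≐f′ 0) (g≐g′ 0)
    ⊛-cong f≐f′ g≐g′ (suc n) =
      cong₂ _+_ (cong₂ _*_ (f≐f′ 0) (g≐g′ (suc n))) (⊛-cong (λ i → f≐f′ (suc i)) g≐g′ n)

    ⊛-zeroˡ : ∀ {f} g → f ≐ 0ₚ → f ⊛ g ≐ 0ₚ
    ⊛-zeroˡ g f≐0 zero    = trans (cong (_* g 0) (f≐0 0)) (ℚP.*-zeroˡ (g 0))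
    ⊛-zeroˡ g f≐0 (suc n) =
      trans (cong₂ _+_ (trans (cong (_* g (suc n)) (f≐0 0)) (ℚP.*-zeroˡ (g (suc n))))
                       (⊛-zeroˡ g (λ i → f≐0 (suc i)) n))
            (ℚP.+-identityˡ 0ℚ)

    ⊛-identityˡ : ∀ g → 1ₚ ⊛ g ≐ g
    ⊛-identityˡ g zero    = ℚP.*-identityˡ (g 0)
    ⊛-identityˡ g (suc n) =
      trans (cong₂ _+_ (ℚP.*-identityˡ (g (suc n))) (⊛-zeroˡ g (λ _ → refl) n))
            (ℚP.+-identityʳ (g (suc n)))

    ⊛-distribʳ : ∀ h f g → (f ⊕ g) ⊛ h ≐ f ⊛ h ⊕ g ⊛ h
    ⊛-distribʳ h f g zero    = ℚP.*-distribʳ-+ (h 0) (f 0) (g 0)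
    ⊛-distribʳ h f g (suc n) =
      trans (cong ((f 0 + g 0) * h (suc n) +_) (⊛-distribʳ h (tail f) (tail g) n))
            (solve 5 (λ a b c x y → (a :+ b) :* c :+ (x :+ y) := (a :* c :+ x) :+ (b :* c :+ y))
                   refl (f 0) (g 0) (h (suc n)) ((tail f ⊛ h) n) ((tail g ⊛ h) n))

    ⊛-scaleˡ : ∀ q f g → (λ i → q * f i) ⊛ g ≐ (λ i → q * (f ⊛ g) i)
    ⊛-scaleˡ q f g zero    = ℚP.*-assoc q (f 0) (g 0)
    ⊛-scaleˡ q f g (suc n) =
      trans (cong (q * f 0 * g (suc n) +_) (⊛-scaleˡ q (tail f) g n))
            (solve 4 (λ q a b x → q :* a :* b :+ q :* x := q :* (a :* b :+ x))
                   refl q (f 0) (g (suc n)) ((tail f ⊛ g) n))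

    ⊛-comm : ∀ f g → f ⊛ g ≐ g ⊛ f
    ⊛-comm f g zero          = ℚP.*-comm (f 0) (g 0)
    ⊛-comm f g (suc zero)    =
      solve 4 (λ a b c d → a :* b :+ c :* d := d :* c :+ b :* a) refl (f 0) (g 1) (f 1) (g 0)
    ⊛-comm f g (suc (suc n)) = begin
      f 0 * g (2 ℕ.+ n) + (tail f ⊛ g) (suc n)
        ≡⟨ cong (f 0 * g (2 ℕ.+ n) +_) (⊛-comm (tail f) g (suc n)) ⟩
      f 0 * g (2 ℕ.+ n) + (g 0 * f (2 ℕ.+ n) + (tail g ⊛ tail f) n)
        ≡⟨ cong (λ r → f 0 * g (2 ℕ.+ n) + (g 0 * f (2 ℕ.+ n) + r)) (⊛-comm (tail g) (tail f) n) ⟩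
      f 0 * g (2 ℕ.+ n) + (g 0 * f (2 ℕ.+ n) + (tail f ⊛ tail g) n)
        ≡⟨ solve 5 (λ a b c d x → a :* b :+ (c :* d :+ x) := c :* d :+ (a :* b :+ x))
                 refl (f 0) (g (2 ℕ.+ n)) (g 0) (f (2 ℕ.+ n)) ((tail f ⊛ tail g) n) ⟩
      g 0 * f (2 ℕ.+ n) + (f 0 * g (2 ℕ.+ n) + (tail f ⊛ tail g) n)
        ≡⟨ cong (g 0 * f (2 ℕ.+ n) +_) (⊛-comm (tail g) f (suc n)) ⟨
      g 0 * f (2 ℕ.+ n) + (tail g ⊛ f) (suc n) ∎
      where open ≡-Reasoning

    ⊛-assoc : ∀ f g h → (f ⊛ g) ⊛ h ≐ f ⊛ (g ⊛ h)
    ⊛-assoc f g h zero    = ℚP.*-assoc (f 0) (g 0) (h 0)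
    ⊛-assoc f g h (suc n) = begin
      f 0 * g 0 * h (suc n) + (tail (f ⊛ g) ⊛ h) n
        ≡⟨ cong (f 0 * g 0 * h (suc n) +_) (⊛-distribʳ h (λ i → f 0 * g (suc i)) (tail f ⊛ g) n) ⟩
      f 0 * g 0 * h (suc n) + (((λ i → f 0 * tail g i) ⊛ h) n + ((tail f ⊛ g) ⊛ h) n)
        ≡⟨ cong₂ (λ a b → f 0 * g 0 * h (suc n) + (a + b))
                 (⊛-scaleˡ (f 0) (tail g) h n) (⊛-assoc (tail f) g h n) ⟩
      f 0 * g 0 * h (suc n) + (f 0 * (tail g ⊛ h) n + (tail f ⊛ (g ⊛ h)) n)
        ≡⟨ solve 5 (λ a b c x y → a :* b :* c :+ (a :* x :+ y) := a :* (b :* c :+ x) :+ y)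
                 refl (f 0) (g 0) (h (suc n)) ((tail g ⊛ h) n) ((tail f ⊛ (g ⊛ h)) n) ⟩
      f 0 * (g 0 * h (suc n) + (tail g ⊛ h) n) + (tail f ⊛ (g ⊛ h)) n ∎
      where open ≡-Reasoning

  ℚ⟦X⟧ : CommutativeRing 0ℓ 0ℓ
  ℚ⟦X⟧ = record
    { Carrier = PS ; _≈_ = _≐_ ; _+_ = _⊕_ ; _*_ = _⊛_ ; -_ = ⊝_ ; 0# = 0ₚ ; 1# = 1ₚ
    ; isCommutativeRing = record
      { isRing = record
        { +-isAbelianGroup = record
          { isGroup = record
            { isMonoid = record
              { isSemigroup = record
                { isMagma = record
                  { isEquivalence = record
                    { refl = λ _ → refl ; sym = λ p i → sym (p i) ; trans = λ p q i → trans (p i) (q i) }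
                  ; ∙-cong = λ p q i → cong₂ _+_ (p i) (q i) }
                ; assoc = λ f g h i → ℚP.+-assoc (f i) (g i) (h i) }
              ; identity = (λ f i → ℚP.+-identityˡ (f i)) , (λ f i → ℚP.+-identityʳ (f i)) }
            ; inverse = (λ f i → ℚP.+-inverseˡ (f i)) , (λ f i → ℚP.+-inverseʳ (f i))
            ; ⁻¹-cong = λ p i → cong -_ (p i) }
          ; comm = λ f g i → ℚP.+-comm (f i) (g i) }
        ; *-cong = ⊛-cong
        ; *-assoc = ⊛-assoc
        ; *-identity = ⊛-identityˡ , (λ g n → trans (⊛-comm g 1ₚ n) (⊛-identityˡ g n))
        ; distrib = (λ h f g n → trans (⊛-comm h (f ⊕ g) n)
                                   (trans (⊛-distribʳ h f g n) (cong₂ _+_ (⊛-comm f h n) (⊛-comm g h n))))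
                  , ⊛-distribʳ }
      ; *-comm = ⊛-comm } }

  open CommutativeRing ℚ⟦X⟧ public
    using (setoid)
    renaming ( refl to ≐-refl; sym to ≐-sym; trans to ≐-trans
             ; +-cong to ⊕-cong; -‿cong to ⊝-cong; -‿inverseʳ to ⊕-inverseʳ
             ; +-identityˡ to ⊕-identityˡ; +-identityʳ to ⊕-identityʳ; *-identityʳ to ⊛-identityʳ )

  constHomomorphism : ACR._-Raw-AlmostCommutative⟶_ ℚ.+-*-rawRing (ACR.fromCommutativeRing ℚ⟦X⟧)
  constHomomorphism = record
    { ⟦_⟧    = const
    ; +-homo = λ { p q zero → refl ; p q (suc i) → sym (ℚP.+-identityˡ 0ℚ) }
    ; *-homo = λ { p q zero → refl
                 ; p q (suc i) → sym (trans (cong₂ _+_ (ℚP.*-zeroʳ p) (⊛-zeroˡ (const q) (λ _ → refl) i))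
                                            (ℚP.+-identityˡ 0ℚ)) }
    ; -‿homo = λ { p zero → refl ; p (suc i) → refl }
    ; 0-homo = λ { zero → refl ; (suc i) → refl }
    ; 1-homo = λ _ → refl }

  _≟const_ : ∀ p q → Maybe (const p ≐ const q)
  p ≟const q with p ℚP.≟ q
  ... | yes refl = just (λ _ → refl)
  ... | no _     = nothing

  module ℚ⟦X⟧-Solver =
    Algebra.Solver.Ring ℚ.+-*-rawRing (ACR.fromCommutativeRing ℚ⟦X⟧) constHomomorphism _≟const_

  open import Algebra.Properties.Semiring.Exp (CommutativeRing.semiring ℚ⟦X⟧) public
    using (_^_; ^-homo-*; ^-assocʳ)

  ⊛-cancelʳ-zero : ∀ f g → f ⊛ g ≐ 0ₚ → g 0 ≡ 1ℚ → f ≐ 0ₚ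
  ⊛-cancelʳ-zero f g fg≐0 g₀≡1 i = vanishes-below (suc i) i (ℕP.n<1+n i)
    where
    leading : ∀ h n → (∀ j → j < n → h j ≡ 0ℚ) → (h ⊛ g) n ≡ h n * g 0
    leading h zero    _     = refl
    leading h (suc n) h<n≡0 =
      trans (cong₂ _+_ (trans (cong (_* g (suc n)) (h<n≡0 0 (s≤s z≤n))) (ℚP.*-zeroˡ (g (suc n))))
                       (leading (tail h) n (λ j j<n → h<n≡0 (suc j) (s≤s j<n))))
            (ℚP.+-identityˡ _)

    vanishes-below : ∀ n j → j < n → f j ≡ 0ℚ
    vanishes-below (suc n) j (s≤s j≤n) with ℕP.m≤n⇒m<n∨m≡n j≤n
    ... | inj₁ j<n  = vanishes-below n j j<n
    ... | inj₂ refl = begin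
      f j           ≡⟨ ℚP.*-identityʳ (f j) ⟨
      f j * 1ℚ      ≡⟨ cong (f j *_) g₀≡1 ⟨
      f j * g 0     ≡⟨ leading f j (vanishes-below j) ⟨
      (f ⊛ g) j     ≡⟨ fg≐0 j ⟩
      0ℚ            ∎
      where open ≡-Reasoning

  ⊛-cancelʳ : ∀ f g h → f ⊛ h ≐ g ⊛ h → h 0 ≡ 1ℚ → f ≐ g
  ⊛-cancelʳ f g h fh≐gh h₀≡1 = ≐-trans (≐-sym f≐[f-g]+g) (≐-trans (⊕-cong f-g≐0 (≐-refl {g})) (⊕-identityˡ g))
    where
    open ℚ⟦X⟧-Solver using (solve; _:=_; _:+_; _:*_; _:-_)
    f≐[f-g]+g : (f ⊕ ⊝ g) ⊕ g ≐ f
    f≐[f-g]+g = solve 2 (λ f g → (f :- g) :+ g := f) ≐-refl f g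
    f-g≐0 : f ⊕ ⊝ g ≐ 0ₚ
    f-g≐0 = ⊛-cancelʳ-zero (f ⊕ ⊝ g) h
      (≐-trans (solve 3 (λ f g h → (f :- g) :* h := f :* h :- g :* h) ≐-refl f g h)
        (≐-trans (⊕-cong fh≐gh (≐-refl {⊝ (g ⊛ h)})) (⊕-inverseʳ (g ⊛ h))))
      h₀≡1

  X : PS
  X (suc zero) = 1ℚ
  X _          = 0ℚ

  X⊛-suc : ∀ h n → (X ⊛ h) (suc n) ≡ h n
  X⊛-suc h n =
    trans (cong₂ _+_ (ℚP.*-zeroˡ (h (suc n))) (trans (⊛-cong tail-X (λ _ → refl) n) (⊛-identityˡ h n)))
          (ℚP.+-identityˡ (h n))
    where
    tail-X : tail X ≐ 1ₚ
    tail-X zero    = refl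
    tail-X (suc _) = refl

  shiftPS-at : ∀ n f i → shiftPS n f (n ℕ.+ i) ≡ f i
  shiftPS-at zero    f i = refl
  shiftPS-at (suc n) f i = shiftPS-at n f i

  shiftPS-below : ∀ n f i → i < n → shiftPS n f i ≡ 0ℚ
  shiftPS-below (suc n) f zero    _         = refl
  shiftPS-below (suc n) f (suc i) (s≤s i<n) = shiftPS-below n f i i<n

  shiftPS≐X^⊛ : ∀ n f → shiftPS n f ≐ X ^ n ⊛ f
  shiftPS≐X^⊛ zero    f i       = sym (⊛-identityˡ f i)
  shiftPS≐X^⊛ (suc n) f zero    = sym (trans (⊛-assoc X (X ^ n) f 0) (ℚP.*-zeroˡ ((X ^ n) 0 * f 0)))
  shiftPS≐X^⊛ (suc n) f (suc i) =
    trans (shiftPS≐X^⊛ n f i) (sym (trans (⊛-assoc X (X ^ n) f (suc i)) (X⊛-suc (X ^ n ⊛ f) i)))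

  X^⊛-cancel-zero : ∀ n f → X ^ n ⊛ f ≐ 0ₚ → f ≐ 0ₚ
  X^⊛-cancel-zero n f X^nf≐0 i =
    trans (sym (shiftPS-at n f i)) (trans (shiftPS≐X^⊛ n f (n ℕ.+ i)) (X^nf≐0 (n ℕ.+ i)))

  [X^k]^n⊛-cancel-zero : ∀ k n f → (X ^ k) ^ n ⊛ f ≐ 0ₚ → f ≐ 0ₚ
  [X^k]^n⊛-cancel-zero k n f Yⁿf≐0 =
    X^⊛-cancel-zero (k ℕ.* n) f (≐-trans (⊛-cong (≐-sym (^-assocʳ X k n)) (≐-refl {f})) Yⁿf≐0)

  sumQ-unfoldˡ : ∀ n F → sumQ (suc n) F ≡ F 0 + sumQ n (λ i → F (suc i))
  sumQ-unfoldˡ zero    F = trans (ℚP.+-identityˡ (F 0)) (sym (ℚP.+-identityʳ (F 0)))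
  sumQ-unfoldˡ (suc n) F =
    trans (cong (_+ F (suc n)) (sumQ-unfoldˡ n F)) (ℚP.+-assoc (F 0) (sumQ n (λ i → F (suc i))) (F (suc n)))

  mulPS≐⊛ : ∀ f g → mulPS f g ≐ f ⊛ g
  mulPS≐⊛ f g zero    = ℚP.+-identityˡ _
  mulPS≐⊛ f g (suc n) =
    trans (sumQ-unfoldˡ (suc n) (λ i → f i * g (suc n ℕ.∸ i)))
          (cong (f 0 * g (suc n) +_) (mulPS≐⊛ (tail f) g n))

  cf-zpow : ∀ n → cf (zpow n) ≐ X ^ n
  cf-zpow n i = trans (shiftPS≐X^⊛ n _ i) (trans (⊛-cong (≐-refl {X ^ n}) δ≐1ₚ i) (⊛-identityʳ (X ^ n) i))
    where
    δ≐1ₚ : cf (zpow 0) ≐ 1ₚ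
    δ≐1ₚ zero    = refl
    δ≐1ₚ (suc _) = refl

open FormalPowerSeries

module LaurentSeries where

  open import Data.Integer using (_+_; +_)

  coeff-at : ∀ k f m {i} → m + + k ≡ + i → coeff (k ⸴ f) m ≡ f i
  coeff-at k f m eq with m + + k | eq
  ... | .(+ _) | refl = refl

  +⊖-cancelʳ : ∀ a i → (a ℕ.+ i) ⊖ a ≡ + i
  +⊖-cancelʳ a i = trans (ℤP.⊖-≥ (ℕP.m≤m+n a i)) (cong +_ (ℕP.m+n∸m≡n a i))

  ≈L-sym : ∀ {A B} → A ≈L B → B ≈L A
  ≈L-sym A≈B m = sym (A≈B m)

  ≈L-trans : ∀ {A B C} → A ≈L B → B ≈L C → A ≈L C
  ≈L-trans A≈B B≈C m = trans (A≈B m) (B≈C m)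

  ⸴-cong : ∀ k {f g} → f ≐ g → (k ⸴ f) ≈L (k ⸴ g)
  ⸴-cong k f≐g m with m + + k
  ... | + i      = f≐g i
  ... | -[1+ _ ] = refl

  ⸴-shift : ∀ k j f → (k ⸴ f) ≈L ((k ℕ.+ j) ⸴ shiftPS j f)
  ⸴-shift k j f m with m + + k in eq
  ... | + i      = sym (trans (coeff-at (k ℕ.+ j) (shiftPS j f) m index) (shiftPS-at j f i))
    where
    index : m + + (k ℕ.+ j) ≡ + (j ℕ.+ i)
    index = trans (sym (ℤP.+-assoc m (+ k) (+ j))) (trans (cong (_+ + j) eq) (cong +_ (ℕP.+-comm i j)))
  ... | -[1+ n ] with m + + (k ℕ.+ j) in eq′
  ...   | -[1+ _ ] = refl
  ...   | + t      = sym (shiftPS-below j f t t<j)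
    where
    t+n+1≡j : t ℕ.+ suc n ≡ j
    t+n+1≡j = ℤP.+-injective (begin
      + t + + suc n                 ≡⟨ cong (_+ + suc n) eq′ ⟨
      m + + (k ℕ.+ j) + + suc n     ≡⟨ cong (_+ + suc n) (ℤP.+-assoc m (+ k) (+ j)) ⟨
      m + + k + + j + + suc n       ≡⟨ cong (λ r → r + + j + + suc n) eq ⟩
      -[1+ n ] + + j + + suc n      ≡⟨ ℤP.+-assoc -[1+ n ] (+ j) (+ suc n) ⟩
      -[1+ n ] + (+ j + + suc n)    ≡⟨ cong (λ r → -[1+ n ] + r) (ℤP.+-comm (+ j) (+ suc n)) ⟩
      -[1+ n ] + (+ suc n + + j)    ≡⟨ ℤP.+-assoc -[1+ n ] (+ suc n) (+ j) ⟨
      -[1+ n ] + + suc n + + j      ≡⟨ cong (_+ + j) (ℤP.n⊖n≡0 (suc n)) ⟩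
      + 0 + + j                     ≡⟨ ℤP.+-identityˡ (+ j) ⟩
      + j                           ∎)
      where open ≡-Reasoning
    t<j : t < j
    t<j = subst (t <_) t+n+1≡j (ℕP.m<m+n t (s≤s z≤n))

  -- X ^ l ⊛ f and X ^ k ⊛ g are the coefficients of z^(k+l) times the two series.
  ≈L-cross : ∀ {k f l g} → X ^ l ⊛ f ≐ X ^ k ⊛ g → (k ⸴ f) ≈L (l ⸴ g)
  ≈L-cross {k} {f} {l} {g} cross =
    ≈L-trans (⸴-shift k l f)
      (≈L-trans (⸴-cong (k ℕ.+ l) (≐-trans (shiftPS≐X^⊛ l f) (≐-trans cross (≐-sym (shiftPS≐X^⊛ k g)))))
        (subst (λ n → (n ⸴ shiftPS k g) ≈L (l ⸴ g)) (ℕP.+-comm l k) (≈L-sym (⸴-shift l k g))))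

  cf≐0ₚ : ∀ {k f} → (k ⸴ f) ≈L 0L → f ≐ 0ₚ
  cf≐0ₚ {k} {f} f≈0 i = begin
    f i                            ≡⟨ coeff-at k f (i ⊖ k) index ⟨
    coeff (k ⸴ f) (i ⊖ k)          ≡⟨ f≈0 (i ⊖ k) ⟩
    coeff 0L (i ⊖ k)               ≡⟨ coeff-0L (i ⊖ k) ⟩
    0ℚ                             ∎
    where
    open ≡-Reasoning
    index : (i ⊖ k) + + k ≡ + i
    index = trans (ℤP.distribˡ-⊖-+-pos k i k) (trans (cong (_⊖ k) (ℕP.+-comm i k)) (+⊖-cancelʳ k i))
    coeff-0L : ∀ m → coeff 0L m ≡ 0ℚ
    coeff-0L m with m + + 0
    ... | + _      = refl
    ... | -[1+ _ ] = refl

  pole-factor : ∀ j k f → (∀ n → coeff ((j ℕ.+ k) ⸴ f) -[1+ j ℕ.+ n ] ≡ 0ℚ) →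
                f ≐ X ^ k ⊛ (λ i → f (k ℕ.+ i))
  pole-factor j k f no-pole = ≐-trans f≐shift (shiftPS≐X^⊛ k _)
    where
    below-k : ∀ i → i < k → f i ≡ 0ℚ
    below-k i i<k with ℕP.m≤n⇒∃[o]m+o≡n i<k
    ... | o , refl = trans (sym (coeff-at (j ℕ.+ (suc i ℕ.+ o)) f -[1+ j ℕ.+ o ] index)) (no-pole o)
      where
      open +-*-Solver
      index : -[1+ j ℕ.+ o ] + + (j ℕ.+ (suc i ℕ.+ o)) ≡ + i
      index = trans (cong (_⊖ suc (j ℕ.+ o))
                          (solve 3 (λ j i o → j :+ (con 1 :+ i :+ o) := con 1 :+ (j :+ o) :+ i) refl j i o))
                    (+⊖-cancelʳ (suc (j ℕ.+ o)) i)

    f≐shift : f ≐ shiftPS k (λ i → f (k ℕ.+ i))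
    f≐shift i with i ℕ.<? k
    ... | yes i<k = trans (below-k i i<k) (sym (shiftPS-below k _ i i<k))
    ... | no  i≮k with ℕP.m≤n⇒∃[o]m+o≡n (ℕP.≮⇒≥ i≮k)
    ...   | o , refl = sym (shiftPS-at k _ o)

open LaurentSeries

module LaurentPolynomials where

  open ℚ⟦X⟧-Solver using (Polynomial; _:+_; _:*_; :-_; _:^_)

  infixl 6 _⊞_ _⊟_
  infixl 7 _⊠_
  infix  8 ⊟_

  data Expr : Set where
    var     : Expr
    z^_     : ℕ → Expr
    _⊞_ _⊠_ : Expr → Expr → Expr
    ⊟_      : Expr → Expr

  _⊟_ : Expr → Expr → Expr
  a ⊟ b = a ⊞ ⊟ b

  ⟦_⟧ : Expr → Laurent → Laurent
  ⟦ var   ⟧ u = u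
  ⟦ z^ n  ⟧ u = zpow n
  ⟦ a ⊞ b ⟧ u = ⟦ a ⟧ u +L ⟦ b ⟧ u
  ⟦ a ⊠ b ⟧ u = ⟦ a ⟧ u *L ⟦ b ⟧ u
  ⟦ ⊟ a   ⟧ u = -L ⟦ a ⟧ u

  -- ord (⟦ e ⟧ u) is weight e * ord u.
  weight : Expr → ℕ
  weight var     = 1
  weight (z^ n)  = 0
  weight (a ⊞ b) = weight a ℕ.+ weight b
  weight (a ⊠ b) = weight a ℕ.+ weight b
  weight (⊟ a)   = weight a

  -- The coefficient series of ⟦ e ⟧ u, where y stands for X ^ ord u and f for cf u.
  ⟦_⟧ₚ : Expr → PS → PS → PS
  ⟦ var   ⟧ₚ y f = f
  ⟦ z^ n  ⟧ₚ y f = X ^ n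
  ⟦ a ⊞ b ⟧ₚ y f = y ^ weight b ⊛ ⟦ a ⟧ₚ y f ⊕ y ^ weight a ⊛ ⟦ b ⟧ₚ y f
  ⟦ a ⊠ b ⟧ₚ y f = ⟦ a ⟧ₚ y f ⊛ ⟦ b ⟧ₚ y f
  ⟦ ⊟ a   ⟧ₚ y f = ⊝ ⟦ a ⟧ₚ y f

  -- Solver syntax for ⟦ e ⟧ₚ; its semantics computes to ⟦ e ⟧ₚ.
  ⟦_⟧ₛ : ∀ {n} → Expr → (X y f : Polynomial n) → Polynomial n
  ⟦ var   ⟧ₛ X y f = f
  ⟦ z^ n  ⟧ₛ X y f = X :^ n
  ⟦ a ⊞ b ⟧ₛ X y f = y :^ weight b :* ⟦ a ⟧ₛ X y f :+ y :^ weight a :* ⟦ b ⟧ₛ X y f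
  ⟦ a ⊠ b ⟧ₛ X y f = ⟦ a ⟧ₛ X y f :* ⟦ b ⟧ₛ X y f
  ⟦ ⊟ a   ⟧ₛ X y f = :- ⟦ a ⟧ₛ X y f

  ^-+-cong : ∀ {x y} m n i j → x ^ m ≐ y ^ i → x ^ n ≐ y ^ j → x ^ (m ℕ.+ n) ≐ y ^ (i ℕ.+ j)
  ^-+-cong {x} {y} m n i j xᵐ≐yⁱ xⁿ≐yʲ =
    ≐-trans (^-homo-* x m n) (≐-trans (⊛-cong xᵐ≐yⁱ xⁿ≐yʲ) (≐-sym (^-homo-* y i j)))

  X^ord-⟦⟧ : ∀ e k f → X ^ ord (⟦ e ⟧ (k ⸴ f)) ≐ (X ^ k) ^ weight e
  X^ord-⟦⟧ var     k f = ≐-sym (⊛-identityʳ (X ^ k))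
  X^ord-⟦⟧ (z^ n)  k f = ≐-refl
  X^ord-⟦⟧ (a ⊞ b) k f =
    ^-+-cong (ord (⟦ a ⟧ (k ⸴ f))) (ord (⟦ b ⟧ (k ⸴ f))) (weight a) (weight b)
             (X^ord-⟦⟧ a k f) (X^ord-⟦⟧ b k f)
  X^ord-⟦⟧ (a ⊠ b) k f =
    ^-+-cong (ord (⟦ a ⟧ (k ⸴ f))) (ord (⟦ b ⟧ (k ⸴ f))) (weight a) (weight b)
             (X^ord-⟦⟧ a k f) (X^ord-⟦⟧ b k f)
  X^ord-⟦⟧ (⊟ a)   k f = X^ord-⟦⟧ a k f

  cf-⟦⟧ : ∀ e k f → cf (⟦ e ⟧ (k ⸴ f)) ≐ ⟦ e ⟧ₚ (X ^ k) f
  cf-⟦⟧ var     k f = ≐-refl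
  cf-⟦⟧ (z^ n)  k f = cf-zpow n
  cf-⟦⟧ (a ⊞ b) k f = ⊕-cong (aligned a b) (aligned b a)
    where
    aligned : ∀ a b →
      shiftPS (ord (⟦ b ⟧ (k ⸴ f))) (cf (⟦ a ⟧ (k ⸴ f))) ≐ (X ^ k) ^ weight b ⊛ ⟦ a ⟧ₚ (X ^ k) f
    aligned a b = ≐-trans (shiftPS≐X^⊛ (ord (⟦ b ⟧ (k ⸴ f))) (cf (⟦ a ⟧ (k ⸴ f))))
                          (⊛-cong (X^ord-⟦⟧ b k f) (cf-⟦⟧ a k f))
  cf-⟦⟧ (a ⊠ b) k f =
    ≐-trans (mulPS≐⊛ (cf (⟦ a ⟧ (k ⸴ f))) (cf (⟦ b ⟧ (k ⸴ f)))) (⊛-cong (cf-⟦⟧ a k f) (cf-⟦⟧ b k f))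
  cf-⟦⟧ (⊟ a)   k f = ⊝-cong (cf-⟦⟧ a k f)

  ⟦⟧ₚ-cong : ∀ e y {f g} → f ≐ g → ⟦ e ⟧ₚ y f ≐ ⟦ e ⟧ₚ y g
  ⟦⟧ₚ-cong var     y f≐g = f≐g
  ⟦⟧ₚ-cong (z^ n)  y f≐g = ≐-refl
  ⟦⟧ₚ-cong (a ⊞ b) y f≐g = ⊕-cong (⊛-cong ≐-refl (⟦⟧ₚ-cong a y f≐g)) (⊛-cong ≐-refl (⟦⟧ₚ-cong b y f≐g))
  ⟦⟧ₚ-cong (a ⊠ b) y f≐g = ⊛-cong (⟦⟧ₚ-cong a y f≐g) (⟦⟧ₚ-cong b y f≐g)
  ⟦⟧ₚ-cong (⊟ a)   y f≐g = ⊝-cong (⟦⟧ₚ-cong a y f≐g)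

  -- cubic u, zL *L u +L zpow 2 and u *L u -L zpow 2 are, by definition,
  -- ⟦ cubicExpr ⟧ u, ⟦ numeratorExpr ⟧ u and ⟦ denominatorExpr ⟧ u.
  cubicExpr numeratorExpr denominatorExpr : Expr
  cubicExpr       = z^ 1 ⊠ var ⊠ var ⊠ var ⊞ (z^ 2 ⊟ z^ 0) ⊠ var ⊠ var ⊟ z^ 3 ⊠ var ⊞ z^ 2
  numeratorExpr   = z^ 1 ⊠ var ⊞ z^ 2
  denominatorExpr = var ⊠ var ⊟ z^ 2

open LaurentPolynomials

cubicₚ : PS → PS → PS
cubicₚ x u = u ⊛ u ⊛ u ⊕ (x ⊕ ⊝ 1ₚ) ⊛ u ⊛ u ⊕ ⊝ (x ⊛ x ⊛ u) ⊕ x ⊛ x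

module _ where
  open ℚ⟦X⟧-Solver using (Polynomial; _:+_; _:*_; _:-_; con)

  cubicₛ : ∀ {n} → (x u : Polynomial n) → Polynomial n
  cubicₛ x u = u :* u :* u :+ (x :- con 1ℚ) :* u :* u :- x :* x :* u :+ x :* x

module ArchEquations
  (x O E A B G : PS) (x₀≡0 : x 0 ≡ 0ℚ)
  (O-eq : O ≐ A ⊕ A ⊛ O) (E-eq : E ≐ B ⊕ A ⊛ E)
  (A-eq : A ≐ x ⊛ (1ₚ ⊕ E)) (B-eq : B ≐ x ⊛ O) (G-eq : G ≐ O ⊕ E)
  where

  open import Relation.Binary.Reasoning.Setoid setoid
  open ℚ⟦X⟧-Solver using (solve; _:=_; _:+_; _:*_; _:-_; con)

  w : PS
  w = 1ₚ ⊕ ⊝ A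

  w⊛O≐A : w ⊛ O ≐ A
  w⊛O≐A = begin
    w ⊛ O                            ≈⟨ solve 2 (λ A O → (con 1ℚ :- A) :* O := O :- A :* O) ≐-refl A O ⟩
    O ⊕ ⊝ (A ⊛ O)                    ≈⟨ ⊕-cong O-eq (≐-refl {⊝ (A ⊛ O)}) ⟩
    A ⊕ A ⊛ O ⊕ ⊝ (A ⊛ O)            ≈⟨ solve 2 (λ A O → A :+ A :* O :- A :* O := A) ≐-refl A O ⟩
    A                                ∎

  w⊛E≐B : w ⊛ E ≐ B
  w⊛E≐B = begin
    w ⊛ E                            ≈⟨ solve 2 (λ A E → (con 1ℚ :- A) :* E := E :- A :* E) ≐-refl A E ⟩
    E ⊕ ⊝ (A ⊛ E)                    ≈⟨ ⊕-cong E-eq (≐-refl {⊝ (A ⊛ E)}) ⟩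
    B ⊕ A ⊛ E ⊕ ⊝ (A ⊛ E)            ≈⟨ solve 3 (λ A B E → B :+ A :* E :- A :* E := B) ≐-refl A B E ⟩
    B                                ∎

  w⊛B≐x⊛A : w ⊛ B ≐ x ⊛ A
  w⊛B≐x⊛A = begin
    w ⊛ B                            ≈⟨ ⊛-cong (≐-refl {w}) B-eq ⟩
    w ⊛ (x ⊛ O)                      ≈⟨ solve 3 (λ w x O → w :* (x :* O) := x :* (w :* O)) ≐-refl w x O ⟩
    x ⊛ (w ⊛ O)                      ≈⟨ ⊛-cong (≐-refl {x}) w⊛O≐A ⟩
    x ⊛ A                            ∎

  G⊛w²≐A⊛[w+x] : G ⊛ (w ⊛ w) ≐ A ⊛ (w ⊕ x)
  G⊛w²≐A⊛[w+x] = begin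
    G ⊛ (w ⊛ w)
      ≈⟨ ⊛-cong G-eq (≐-refl {w ⊛ w}) ⟩
    (O ⊕ E) ⊛ (w ⊛ w)
      ≈⟨ solve 3 (λ O E w → (O :+ E) :* (w :* w) := w :* (w :* O) :+ w :* (w :* E)) ≐-refl O E w ⟩
    w ⊛ (w ⊛ O) ⊕ w ⊛ (w ⊛ E)
      ≈⟨ ⊕-cong (⊛-cong (≐-refl {w}) w⊛O≐A) (⊛-cong (≐-refl {w}) w⊛E≐B) ⟩
    w ⊛ A ⊕ w ⊛ B
      ≈⟨ ⊕-cong (≐-refl {w ⊛ A}) w⊛B≐x⊛A ⟩
    w ⊛ A ⊕ x ⊛ A
      ≈⟨ solve 3 (λ w x A → w :* A :+ x :* A := A :* (w :+ x)) ≐-refl w x A ⟩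
    A ⊛ (w ⊕ x) ∎

  w²⊛A≐x⊛[w²+x⊛A] : w ⊛ w ⊛ A ≐ x ⊛ (w ⊛ w ⊕ x ⊛ A)
  w²⊛A≐x⊛[w²+x⊛A] = begin
    w ⊛ w ⊛ A
      ≈⟨ ⊛-cong (≐-refl {w ⊛ w}) A-eq ⟩
    w ⊛ w ⊛ (x ⊛ (1ₚ ⊕ E))
      ≈⟨ solve 3 (λ w x E → w :* w :* (x :* (con 1ℚ :+ E)) := x :* (w :* w :+ w :* (w :* E))) ≐-refl w x E ⟩
    x ⊛ (w ⊛ w ⊕ w ⊛ (w ⊛ E))
      ≈⟨ ⊛-cong (≐-refl {x}) (⊕-cong (≐-refl {w ⊛ w}) (⊛-cong (≐-refl {w}) w⊛E≐B)) ⟩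
    x ⊛ (w ⊛ w ⊕ w ⊛ B)
      ≈⟨ ⊛-cong (≐-refl {x}) (⊕-cong (≐-refl {w ⊛ w}) w⊛B≐x⊛A) ⟩
    x ⊛ (w ⊛ w ⊕ x ⊛ A) ∎

  cubic-w : cubicₚ x w ≐ 0ₚ
  cubic-w = begin
    cubicₚ x w
      ≈⟨ solve 2 (λ x A → let w = con 1ℚ :- A in
                   cubicₛ x w := x :* (w :* w :+ x :* A) :- w :* w :* A) ≐-refl x A ⟩
    x ⊛ (w ⊛ w ⊕ x ⊛ A) ⊕ ⊝ (w ⊛ w ⊛ A)
      ≈⟨ ⊕-cong (≐-refl {x ⊛ (w ⊛ w ⊕ x ⊛ A)}) (⊝-cong w²⊛A≐x⊛[w²+x⊛A]) ⟩
    x ⊛ (w ⊛ w ⊕ x ⊛ A) ⊕ ⊝ (x ⊛ (w ⊛ w ⊕ x ⊛ A))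
      ≈⟨ ⊕-inverseʳ (x ⊛ (w ⊛ w ⊕ x ⊛ A)) ⟩
    0ₚ ∎

  A₀≡0 : A 0 ≡ 0ℚ
  A₀≡0 = trans (A-eq 0) (trans (cong (ℚ._* (1ℚ ℚ.+ E 0)) x₀≡0) (ℚP.*-zeroˡ (1ℚ ℚ.+ E 0)))

  w₀≡1 : w 0 ≡ 1ℚ
  w₀≡1 = cong (λ a → 1ℚ ℚ.+ ℚ.- a) A₀≡0

  G⊛[w-x]≐x : G ⊛ (w ⊕ ⊝ x) ≐ x
  G⊛[w-x]≐x = ⊛-cancelʳ (G ⊛ (w ⊕ ⊝ x)) x (w ⊛ w) (begin
    G ⊛ (w ⊕ ⊝ x) ⊛ (w ⊛ w)
      ≈⟨ solve 3 (λ G w x → G :* (w :- x) :* (w :* w) := G :* (w :* w) :* (w :- x)) ≐-refl G w x ⟩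
    G ⊛ (w ⊛ w) ⊛ (w ⊕ ⊝ x)
      ≈⟨ ⊛-cong G⊛w²≐A⊛[w+x] (≐-refl {w ⊕ ⊝ x}) ⟩
    A ⊛ (w ⊕ x) ⊛ (w ⊕ ⊝ x)
      ≈⟨ solve 2 (λ x A → let w = con 1ℚ :- A in
                   A :* (w :+ x) :* (w :- x) := x :* (w :* w) :- cubicₛ x w) ≐-refl x A ⟩
    x ⊛ (w ⊛ w) ⊕ ⊝ cubicₚ x w
      ≈⟨ ⊕-cong (≐-refl {x ⊛ (w ⊛ w)}) (⊝-cong cubic-w) ⟩
    x ⊛ (w ⊛ w) ⊕ ⊝ 0ₚ
      ≈⟨ ⊕-identityʳ (x ⊛ (w ⊛ w)) ⟩
    x ⊛ (w ⊛ w) ∎) (cong₂ ℚ._*_ w₀≡1 w₀≡1)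

  cubic-root-unique : ∀ u → cubicₚ x u ≐ 0ₚ → u 0 ≡ 1ℚ → u ≐ w
  cubic-root-unique u cubic-u u₀≡1 = ⊛-cancelʳ u w R (begin
    u ⊛ R
      ≈⟨ solve 3 (λ x u w → let R = u :* u :+ u :* w :+ w :* w :+ (x :- con 1ℚ) :* (u :+ w) :- x :* x in
                   u :* R := cubicₛ x u :- cubicₛ x w :+ w :* R) ≐-refl x u w ⟩
    cubicₚ x u ⊕ ⊝ cubicₚ x w ⊕ w ⊛ R
      ≈⟨ ⊕-cong (⊕-cong cubic-u (⊝-cong cubic-w)) (≐-refl {w ⊛ R}) ⟩
    0ₚ ⊕ ⊝ 0ₚ ⊕ w ⊛ R
      ≈⟨ ⊕-identityˡ (w ⊛ R) ⟩
    w ⊛ R ∎) (R₀≡1 (u 0) (w 0) (x 0) u₀≡1 w₀≡1 x₀≡0)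
    where
    R : PS
    R = u ⊛ u ⊕ u ⊛ w ⊕ w ⊛ w ⊕ (x ⊕ ⊝ 1ₚ) ⊛ (u ⊕ w) ⊕ ⊝ (x ⊛ x)
    R₀≡1 : ∀ a b c → a ≡ 1ℚ → b ≡ 1ℚ → c ≡ 0ℚ →
           a ℚ.* a ℚ.+ a ℚ.* b ℚ.+ b ℚ.* b ℚ.+ (c ℚ.+ ℚ.- 1ℚ) ℚ.* (a ℚ.+ b) ℚ.+ ℚ.- (c ℚ.* c) ≡ 1ℚ
    R₀≡1 _ _ _ refl refl refl = refl

  G⊛[u²-x²]≐x⊛[u+x] : ∀ u → cubicₚ x u ≐ 0ₚ → u 0 ≡ 1ℚ → G ⊛ (u ⊛ u ⊕ ⊝ (x ⊛ x)) ≐ x ⊛ (u ⊕ x)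
  G⊛[u²-x²]≐x⊛[u+x] u cubic-u u₀≡1 = begin
    G ⊛ (u ⊛ u ⊕ ⊝ (x ⊛ x))
      ≈⟨ ⊛-cong (≐-refl {G}) (⊕-cong (⊛-cong u≐w u≐w) (≐-refl {⊝ (x ⊛ x)})) ⟩
    G ⊛ (w ⊛ w ⊕ ⊝ (x ⊛ x))
      ≈⟨ solve 3 (λ G w x → G :* (w :* w :- x :* x) := G :* (w :- x) :* (w :+ x)) ≐-refl G w x ⟩
    G ⊛ (w ⊕ ⊝ x) ⊛ (w ⊕ x)
      ≈⟨ ⊛-cong G⊛[w-x]≐x (⊕-cong (≐-sym u≐w) (≐-refl {x})) ⟩
    x ⊛ (u ⊕ x) ∎
    where
    u≐w : u ≐ w
    u≐w = cubic-root-unique u cubic-u u₀≡1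

module Languages where

  open import Data.Rational using (_+_; _*_)

  infixr 6 _∪_
  infixr 7 _·_

  Lang : Set
  Lang = List Step → Bool

  ∂ : Step → Lang → Lang
  ∂ y L s = L (y ∷ s)

  ε : Lang
  ε []      = true
  ε (_ ∷ _) = false

  ⟨_⟩ : Step → Lang
  ⟨ U ⟩ (U ∷ []) = true
  ⟨ D ⟩ (D ∷ []) = true
  ⟨ _ ⟩ _        = false

  _∪_ : Lang → Lang → Lang
  (A ∪ B) s = A s ∨ B s

  _·_ : Lang → Lang → Lang
  (A · B) []      = A [] ∧ B []
  (A · B) (y ∷ s) = (A [] ∧ B (y ∷ s)) ∨ (∂ y A · B) s

  Disjoint : Lang → Lang → Set
  Disjoint A B = ∀ s → A s ∧ B s ≡ false

  Unambiguous : Lang → Lang → Set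
  Unambiguous A B = ∀ p q p′ q′ → p ++ q ≡ p′ ++ q′ →
    A p ≡ true → B q ≡ true → A p′ ≡ true → B q′ ≡ true → p ≡ p′

  PrefixFree : Lang → Set
  PrefixFree A = ∀ p y s → A p ≡ true → A (p ++ y ∷ s) ≡ false

  true≢false : true ≡ false → ⊥
  true≢false ()

  ∧-true : ∀ {a b} → a ∧ b ≡ true → a ≡ true × b ≡ true
  ∧-true {a} {b} a∧b = BoolP.∧-conicalˡ a b a∧b , BoolP.∧-conicalʳ a b a∧b

  ·-emptyˡ : ∀ A B → (∀ s → A s ≡ false) → ∀ s → (A · B) s ≡ false
  ·-emptyˡ A B A≡∅ []      rewrite A≡∅ [] = refl
  ·-emptyˡ A B A≡∅ (y ∷ s) rewrite A≡∅ [] = ·-emptyˡ (∂ y A) B (λ t → A≡∅ (y ∷ t)) s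

  ·-identityˡ : ∀ A B → (∀ s → A s ≡ ε s) → ∀ s → (A · B) s ≡ B s
  ·-identityˡ A B A≡ε []      rewrite A≡ε [] = refl
  ·-identityˡ A B A≡ε (y ∷ s) rewrite A≡ε [] | ·-emptyˡ (∂ y A) B (λ t → A≡ε (y ∷ t)) s = BoolP.∨-identityʳ _

  ·-split : ∀ A B s → (A · B) s ≡ true → ∃[ p ] ∃[ q ] s ≡ p ++ q × A p ≡ true × B q ≡ true
  ·-split A B []      AB with ∧-true {A []} AB
  ... | Ap , Bq = [] , [] , refl , Ap , Bq
  ·-split A B (y ∷ s) AB with A [] ∧ B (y ∷ s) in first
  ... | true  = let Ap , Bq = ∧-true first in [] , y ∷ s , refl , Ap , Bq
  ... | false with ·-split (∂ y A) B s AB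
  ...   | p , q , refl , Ap , Bq = y ∷ p , q , refl , Ap , Bq

  unambiguous-∂ : ∀ {A B} y → Unambiguous A B → Unambiguous (∂ y A) B
  unambiguous-∂ y unamb p q p′ q′ eq Ap Bq Ap′ Bq′ =
    ListP.∷-injectiveʳ (unamb (y ∷ p) q (y ∷ p′) q′ (cong (y ∷_) eq) Ap Bq Ap′ Bq′)

  prefixFree⇒unambiguous : ∀ {A} B → PrefixFree A → Unambiguous A B
  prefixFree⇒unambiguous B pf []      q []       q′ eq Ap Bq Ap′ Bq′ = refl
  prefixFree⇒unambiguous B pf []      q (y ∷ p′) q′ eq Ap Bq Ap′ Bq′ =
    ⊥-elim (true≢false (trans (sym Ap′) (pf [] y p′ Ap)))
  prefixFree⇒unambiguous B pf (y ∷ p) q []       q′ eq Ap Bq Ap′ Bq′ =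
    ⊥-elim (true≢false (trans (sym Ap) (pf [] y p Ap′)))
  prefixFree⇒unambiguous B pf (y ∷ p) q (_ ∷ p′) q′ eq Ap Bq Ap′ Bq′ with ListP.∷-injectiveˡ eq
  ... | refl = cong (y ∷_)
    (prefixFree⇒unambiguous B (λ p z s → pf (y ∷ p) z s) p q p′ q′ (ListP.∷-injectiveʳ eq) Ap Bq Ap′ Bq′)

  ⟨⟩-prefixFree : ∀ y → PrefixFree ⟨ y ⟩
  ⟨⟩-prefixFree U (U ∷ []) _ _ _ = refl
  ⟨⟩-prefixFree D (D ∷ []) _ _ _ = refl

  ·⟨⟩-unambiguous : ∀ A y → Unambiguous A ⟨ y ⟩
  ·⟨⟩-unambiguous A y p q p′ q′ eq _ yq _ yq′ with ⟨⟩-single y q yq | ⟨⟩-single y q′ yq′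
    where
    ⟨⟩-single : ∀ y q → ⟨ y ⟩ q ≡ true → q ≡ y ∷ []
    ⟨⟩-single U (U ∷ []) _ = refl
    ⟨⟩-single D (D ∷ []) _ = refl
  ... | refl | refl = ListP.++-cancelʳ (y ∷ []) p p′ eq

  first-step-disjoint : ∀ A B y → Unambiguous A B → Disjoint (λ t → A [] ∧ B (y ∷ t)) (∂ y A · B)
  first-step-disjoint A B y unamb t = BoolP.¬-not λ both → clash (∧-true both)
    where
    clash : (A [] ∧ B (y ∷ t)) ≡ true × (∂ y A · B) t ≡ true → ⊥
    clash (now , later) with ∧-true {A []} now | ·-split (∂ y A) B t later
    ... | Aε , Byt | p , q , refl , Ayp , Bq with unamb [] (y ∷ p ++ q) (y ∷ p) q refl Aε Byt Ayp Bq
    ... | ()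

  indicator : Bool → ℚ
  indicator true  = 1ℚ
  indicator false = 0ℚ

  -- gf L m is the number of words of length m in L.
  gf : Lang → PS
  gf L zero    = indicator (L [])
  gf L (suc m) = gf (∂ U L) m + gf (∂ D L) m

  gf-cong : ∀ {L L′} → (∀ s → L s ≡ L′ s) → gf L ≐ gf L′
  gf-cong L≡L′ zero    = cong indicator (L≡L′ [])
  gf-cong L≡L′ (suc m) = cong₂ _+_ (gf-cong (λ t → L≡L′ (U ∷ t)) m) (gf-cong (λ t → L≡L′ (D ∷ t)) m)

  gf-empty : ∀ L → (∀ s → L s ≡ false) → gf L ≐ 0ₚ
  gf-empty L L≡∅ zero    = cong indicator (L≡∅ [])
  gf-empty L L≡∅ (suc m) =
    cong₂ _+_ (gf-empty (∂ U L) (λ t → L≡∅ (U ∷ t)) m) (gf-empty (∂ D L) (λ t → L≡∅ (D ∷ t)) m)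

  gf-ε : gf ε ≐ 1ₚ
  gf-ε zero    = refl
  gf-ε (suc m) = cong₂ _+_ (gf-empty (∂ U ε) (λ _ → refl) m) (gf-empty (∂ D ε) (λ _ → refl) m)

  gf-⟨⟩ : ∀ y → gf ⟨ y ⟩ ≐ X
  gf-⟨⟩ y zero    = only-y y
    where
    only-y : ∀ y → indicator (⟨ y ⟩ []) ≡ 0ℚ
    only-y U = refl
    only-y D = refl
  gf-⟨⟩ U (suc m) =
    trans (cong₂ _+_ (trans (gf-cong ∂⟨y⟩≡ε m) (gf-ε m)) (gf-empty (∂ D ⟨ U ⟩) (λ _ → refl) m)) (unit m)
    where
    ∂⟨y⟩≡ε : ∀ t → ⟨ U ⟩ (U ∷ t) ≡ ε t
    ∂⟨y⟩≡ε []      = refl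
    ∂⟨y⟩≡ε (_ ∷ _) = refl
    unit : ∀ m → 1ₚ m + 0ℚ ≡ X (suc m)
    unit zero    = refl
    unit (suc m) = refl
  gf-⟨⟩ D (suc m) =
    trans (cong₂ _+_ (gf-empty (∂ U ⟨ D ⟩) (λ _ → refl) m) (trans (gf-cong ∂⟨y⟩≡ε m) (gf-ε m))) (unit m)
    where
    ∂⟨y⟩≡ε : ∀ t → ⟨ D ⟩ (D ∷ t) ≡ ε t
    ∂⟨y⟩≡ε []      = refl
    ∂⟨y⟩≡ε (_ ∷ _) = refl
    unit : ∀ m → 0ℚ + 1ₚ m ≡ X (suc m)
    unit zero    = refl
    unit (suc m) = refl

  gf-∪ : ∀ A B → Disjoint A B → gf (A ∪ B) ≐ gf A ⊕ gf B
  gf-∪ A B disjoint zero    = indicator-∨ (A []) (B []) (disjoint [])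
    where
    indicator-∨ : ∀ a b → a ∧ b ≡ false → indicator (a ∨ b) ≡ indicator a + indicator b
    indicator-∨ true  false _ = refl
    indicator-∨ false true  _ = refl
    indicator-∨ false false _ = refl
  gf-∪ A B disjoint (suc m) =
    trans (cong₂ _+_ (gf-∪ (∂ U A) (∂ U B) (λ t → disjoint (U ∷ t)) m)
                     (gf-∪ (∂ D A) (∂ D B) (λ t → disjoint (D ∷ t)) m))
          (solve 4 (λ a b c d → (a :+ b) :+ (c :+ d) := (a :+ c) :+ (b :+ d)) refl
                 (gf (∂ U A) m) (gf (∂ U B) m) (gf (∂ D A) m) (gf (∂ D B) m))
    where open ℚ-Solver.+-*-Solver

  gf-scale : ∀ b L → gf (λ s → b ∧ L s) ≐ (λ m → indicator b * gf L m)
  gf-scale true  L m = sym (ℚP.*-identityˡ (gf L m))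
  gf-scale false L m = trans (gf-empty _ (λ _ → refl) m) (sym (ℚP.*-zeroˡ (gf L m)))

  gf-· : ∀ A B → Unambiguous A B → gf (A · B) ≐ gf A ⊛ gf B
  gf-· A B unamb zero    = indicator-∧ (A []) (B [])
    where
    indicator-∧ : ∀ a b → indicator (a ∧ b) ≡ indicator a * indicator b
    indicator-∧ true  true  = refl
    indicator-∧ true  false = refl
    indicator-∧ false b     = sym (ℚP.*-zeroˡ (indicator b))
  gf-· A B unamb (suc m) = begin
    gf (∂ U (A · B)) m + gf (∂ D (A · B)) m
      ≡⟨ cong₂ _+_ (first-step U) (first-step D) ⟩
    (a * gf (∂ U B) m + (gf (∂ U A) ⊛ gf B) m) + (a * gf (∂ D B) m + (gf (∂ D A) ⊛ gf B) m)
      ≡⟨ solve 5 (λ a x y u v → (a :* x :+ u) :+ (a :* y :+ v) := a :* (x :+ y) :+ (u :+ v)) refl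
               a (gf (∂ U B) m) (gf (∂ D B) m) ((gf (∂ U A) ⊛ gf B) m) ((gf (∂ D A) ⊛ gf B) m) ⟩
    a * gf B (suc m) + ((gf (∂ U A) ⊛ gf B) m + (gf (∂ D A) ⊛ gf B) m)
      ≡⟨ cong (a * gf B (suc m) +_) (⊛-distribʳ (gf B) (gf (∂ U A)) (gf (∂ D A)) m) ⟨
    (gf A ⊛ gf B) (suc m) ∎
    where
    open ≡-Reasoning
    open ℚ-Solver.+-*-Solver
    a : ℚ
    a = indicator (A [])
    first-step : ∀ y → gf (∂ y (A · B)) m ≡ a * gf (∂ y B) m + (gf (∂ y A) ⊛ gf B) m
    first-step y = trans (gf-∪ (λ t → A [] ∧ B (y ∷ t)) (∂ y A · B) (first-step-disjoint A B y unamb) m)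
                         (cong₂ _+_ (gf-scale (A []) (∂ y B) m) (gf-· (∂ y A) B (unambiguous-∂ y unamb) m))

open Languages

module DescentAutomaton where

  open import Relation.Binary.Reasoning.Setoid setoid hiding (start)

  -- The parity of the descent being read; none if the last step read was an up-step,
  -- or nothing has been read yet.
  data Parity : Set where
    none odd even : Parity

  flip : Parity → Parity
  flip none = odd
  flip odd  = even
  flip even = odd

  data State : Set where
    dead : State
    at   : (height : ℕ) → Parity → State

  -- An up-step ends the current descent, which then is not the last one and must be odd.
  up : ℕ → Parity → State
  up h even = dead
  up h _    = at (suc h) none

  down : ℕ → Parity → State
  down zero    p = dead
  down (suc h) p = at h (flip p)

  step : State → Step → State
  step dead     _ = dead
  step (at h p) U = up h p
  step (at h p) D = down h p

  -- An arch may not continue once it is back on the axis.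
  archStep : State → Step → State
  archStep (at zero odd)  _ = dead
  archStep (at zero even) _ = dead
  archStep σ              y = step σ y

  start : State
  start = at 0 none

  final : (Parity → Bool) → State → Bool
  final F (at zero p) = F p
  final F _           = false

  accepts archAccepts : (Parity → Bool) → State → Lang
  accepts     F σ s = final F (foldl step σ s)
  archAccepts F σ s = final F (foldl archStep σ s)

  -- Paths F: walks from the axis to the axis whose descents are odd except the last, whose parity
  -- satisfies F (none for the empty walk); Arches F: those touching the axis only at their ends.
  Paths Arches : (Parity → Bool) → Lang
  Paths  F = accepts F start
  Arches F = archAccepts F start

  lastOdd lastEven lastAny lastNone : Parity → Bool
  lastOdd odd   = true
  lastOdd _     = false
  lastEven even = true
  lastEven _    = false
  lastAny none  = false
  lastAny _     = true
  lastNone none = true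
  lastNone _    = false

  accepts-dead : ∀ F s → accepts F dead s ≡ false
  accepts-dead F []      = refl
  accepts-dead F (_ ∷ s) = accepts-dead F s

  archAccepts-dead : ∀ F s → archAccepts F dead s ≡ false
  archAccepts-dead F []      = refl
  archAccepts-dead F (_ ∷ s) = archAccepts-dead F s

  -- First-return decomposition: a path is an arch, possibly followed by a further path;
  -- an arch that is followed by something must end with an odd descent.
  accepts-decomposition : ∀ F → F none ≡ false → ∀ σ s →
    accepts F σ s ≡ (archAccepts F σ ∪ archAccepts lastOdd σ · Paths F) s
  accepts-decomposition F Fnone σ [] rewrite Fnone =
    sym (trans (cong (final F σ ∨_) (BoolP.∧-zeroʳ (final lastOdd σ))) (BoolP.∨-identityʳ (final F σ)))
  accepts-decomposition F Fnone dead (y ∷ s) =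
    trans (accepts-dead F s)
          (sym (cong₂ _∨_ (archAccepts-dead F s) (·-emptyˡ _ (Paths F) (archAccepts-dead lastOdd) s)))
  accepts-decomposition F Fnone (at (suc h) p) (y ∷ s) =
    accepts-decomposition F Fnone (step (at (suc h) p) y) s
  accepts-decomposition F Fnone (at zero none) (y ∷ s) = accepts-decomposition F Fnone (step start y) s
  accepts-decomposition F Fnone (at zero odd)  (y ∷ s)
    rewrite archAccepts-dead F s | ·-emptyˡ _ (Paths F) (archAccepts-dead lastOdd) s =
      trans (same-as-start y) (sym (BoolP.∨-identityʳ _))
    where
    same-as-start : ∀ y → accepts F (step (at zero odd) y) s ≡ Paths F (y ∷ s)
    same-as-start U = refl
    same-as-start D = refl
  accepts-decomposition F Fnone (at zero even) (y ∷ s)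
    rewrite archAccepts-dead F s | ·-emptyˡ _ (Paths F) (archAccepts-dead lastOdd) s = dead-end y
    where
    dead-end : ∀ y → accepts F (step (at zero even) y) s ≡ false
    dead-end U = accepts-dead F s
    dead-end D = accepts-dead F s

  raise : State → State
  raise dead     = dead
  raise (at h p) = at (suc h) p

  -- Inside an arch the walk is a raised path; the closing down-step extends its last descent.
  archAccepts-raise : ∀ F σ s → archAccepts F (raise σ) s ≡ (accepts (F ∘ flip) σ · ⟨ D ⟩) s
  archAccepts-raise F dead     []      = refl
  archAccepts-raise F (at h p) []      = sym (BoolP.∧-zeroʳ _)
  archAccepts-raise F dead     (y ∷ s) =
    trans (archAccepts-dead F s) (sym (·-emptyˡ _ ⟨ D ⟩ (accepts-dead (F ∘ flip)) s))
  archAccepts-raise F (at h none) (U ∷ s) rewrite BoolP.∧-zeroʳ (final (F ∘ flip) (at h none)) =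
    archAccepts-raise F (at (suc h) none) s
  archAccepts-raise F (at h odd)  (U ∷ s) rewrite BoolP.∧-zeroʳ (final (F ∘ flip) (at h odd)) =
    archAccepts-raise F (at (suc h) none) s
  archAccepts-raise F (at h even) (U ∷ s) rewrite BoolP.∧-zeroʳ (final (F ∘ flip) (at h even)) =
    archAccepts-raise F dead s
  archAccepts-raise F (at (suc h) p) (D ∷ s) = archAccepts-raise F (at h (flip p)) s
  archAccepts-raise F (at zero p) (D ∷ []) =
    sym (trans (BoolP.∨-identityʳ _) (BoolP.∧-identityʳ _))
  archAccepts-raise F (at zero p) (D ∷ y ∷ s)
    rewrite BoolP.∧-zeroʳ (F (flip p)) | ·-emptyˡ _ ⟨ D ⟩ (accepts-dead (F ∘ flip)) (y ∷ s) = closed p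
    where
    closed : ∀ p → archAccepts F (at zero (flip p)) (y ∷ s) ≡ false
    closed none = archAccepts-dead F s
    closed odd  = archAccepts-dead F s
    closed even = archAccepts-dead F s

  Arches≡U·raised : ∀ F → F none ≡ false → ∀ s → Arches F s ≡ (⟨ U ⟩ · archAccepts F (raise start)) s
  Arches≡U·raised F Fnone []      = Fnone
  Arches≡U·raised F Fnone (U ∷ s) = sym (·-identityˡ _ _ ∂⟨U⟩≡ε s)
    where
    ∂⟨U⟩≡ε : ∀ t → ⟨ U ⟩ (U ∷ t) ≡ ε t
    ∂⟨U⟩≡ε []      = refl
    ∂⟨U⟩≡ε (_ ∷ _) = refl
  Arches≡U·raised F Fnone (D ∷ s) = trans (archAccepts-dead F s) (sym (·-emptyˡ _ _ (λ _ → refl) s))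

  archAccepts-closed : ∀ F F′ → F none ≡ false → ∀ σ p y s →
    archAccepts F σ p ≡ true → archAccepts F′ σ (p ++ y ∷ s) ≡ false
  archAccepts-closed F F′ Fnone σ p y s Fp
    rewrite ListP.foldl-++ archStep σ p (y ∷ s) = closed (foldl archStep σ p) Fp
    where
    closed : ∀ τ → final F τ ≡ true → final F′ (foldl archStep (archStep τ y) s) ≡ false
    closed dead           ()
    closed (at (suc h) p) ()
    closed (at zero none) Fτ = ⊥-elim (true≢false (trans (sym Fτ) Fnone))
    closed (at zero odd)  _  = archAccepts-dead F′ s
    closed (at zero even) _  = archAccepts-dead F′ s

  Arches-prefixFree : ∀ F → F none ≡ false → PrefixFree (Arches F)
  Arches-prefixFree F Fnone = archAccepts-closed F F Fnone start

  Arches-disjoint : ∀ F → F none ≡ false → Disjoint (Arches F) (Arches lastOdd · Paths F)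
  Arches-disjoint F Fnone s = BoolP.¬-not λ both → clash (∧-true both)
    where
    clash : Arches F s ≡ true × (Arches lastOdd · Paths F) s ≡ true → ⊥
    clash (arch , split) with ·-split (Arches lastOdd) (Paths F) s split
    ... | p , []    , _    , _     , Fε = true≢false (trans (sym Fε) Fnone)
    ... | p , y ∷ q , refl , archp , _  =
      true≢false (trans (sym arch) (archAccepts-closed lastOdd F refl start p y q archp))

  accepts-cong : ∀ {F F′} → (∀ p → F p ≡ F′ p) → ∀ σ s → accepts F σ s ≡ accepts F′ σ s
  accepts-cong F≡F′ σ s = final-cong (foldl step σ s)
    where
    final-cong : ∀ τ → final _ τ ≡ final _ τ
    final-cong dead           = refl
    final-cong (at zero p)    = F≡F′ p
    final-cong (at (suc _) _) = refl

  accepts-∪ : ∀ {H F F′} → (∀ p → H p ≡ F p ∨ F′ p) → ∀ σ s → accepts H σ s ≡ (accepts F σ ∪ accepts F′ σ) s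
  accepts-∪ H≡F∪F′ σ s = final-∪ (foldl step σ s)
    where
    final-∪ : ∀ τ → final _ τ ≡ final _ τ ∨ final _ τ
    final-∪ dead           = refl
    final-∪ (at zero p)    = H≡F∪F′ p
    final-∪ (at (suc _) _) = refl

  accepts-disjoint : ∀ {F F′} → (∀ p → F p ∧ F′ p ≡ false) → ∀ σ → Disjoint (accepts F σ) (accepts F′ σ)
  accepts-disjoint F∩F′≡∅ σ s = final-disjoint (foldl step σ s)
    where
    final-disjoint : ∀ τ → final _ τ ∧ final _ τ ≡ false
    final-disjoint dead           = refl
    final-disjoint (at zero p)    = F∩F′≡∅ p
    final-disjoint (at (suc _) _) = refl

  Paths-lastNone : ∀ s → Paths lastNone s ≡ ε s
  Paths-lastNone []      = refl
  Paths-lastNone (y ∷ s) = never-back start y s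
    where
    step-leaves-start : ∀ σ y → final lastNone (step σ y) ≡ false
    step-leaves-start dead                 _ = refl
    step-leaves-start (at h none)          U = refl
    step-leaves-start (at h odd)           U = refl
    step-leaves-start (at h even)          U = refl
    step-leaves-start (at zero p)          D = refl
    step-leaves-start (at (suc zero) none) D = refl
    step-leaves-start (at (suc zero) odd)  D = refl
    step-leaves-start (at (suc zero) even) D = refl
    step-leaves-start (at (suc (suc h)) p) D = refl
    never-back : ∀ σ y s → accepts lastNone σ (y ∷ s) ≡ false
    never-back σ y []       = step-leaves-start σ y
    never-back σ y (y′ ∷ s) = never-back (step σ y) y′ s

  gf-Paths : ∀ F → F none ≡ false → gf (Paths F) ≐ gf (Arches F) ⊕ gf (Arches lastOdd) ⊛ gf (Paths F)
  gf-Paths F Fnone = begin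
    gf (Paths F)
      ≈⟨ gf-cong (accepts-decomposition F Fnone start) ⟩
    gf (Arches F ∪ Arches lastOdd · Paths F)
      ≈⟨ gf-∪ _ _ (Arches-disjoint F Fnone) ⟩
    gf (Arches F) ⊕ gf (Arches lastOdd · Paths F)
      ≈⟨ ⊕-cong (≐-refl {gf (Arches F)}) (gf-· _ _ unambiguous) ⟩
    gf (Arches F) ⊕ gf (Arches lastOdd) ⊛ gf (Paths F) ∎
    where
    unambiguous : Unambiguous (Arches lastOdd) (Paths F)
    unambiguous = prefixFree⇒unambiguous (Paths F) (Arches-prefixFree lastOdd refl)

  gf-Arches : ∀ F → F none ≡ false → gf (Arches F) ≐ X ⊛ (gf (Paths (F ∘ flip)) ⊛ X)
  gf-Arches F Fnone = begin
    gf (Arches F)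
      ≈⟨ gf-cong (Arches≡U·raised F Fnone) ⟩
    gf (⟨ U ⟩ · archAccepts F (raise start))
      ≈⟨ gf-· _ _ (prefixFree⇒unambiguous _ (⟨⟩-prefixFree U)) ⟩
    gf ⟨ U ⟩ ⊛ gf (archAccepts F (raise start))
      ≈⟨ ⊛-cong (gf-⟨⟩ U) (gf-cong (archAccepts-raise F start)) ⟩
    X ⊛ gf (Paths (F ∘ flip) · ⟨ D ⟩)
      ≈⟨ ⊛-cong (≐-refl {X}) (gf-· _ _ (·⟨⟩-unambiguous _ D)) ⟩
    X ⊛ (gf (Paths (F ∘ flip)) ⊛ gf ⟨ D ⟩)
      ≈⟨ ⊛-cong (≐-refl {X}) (⊛-cong (≐-refl {gf (Paths (F ∘ flip))}) (gf-⟨⟩ D)) ⟩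
    X ⊛ (gf (Paths (F ∘ flip)) ⊛ X) ∎

  gf-Paths-lastOdd∘flip : gf (Paths (lastOdd ∘ flip)) ≐ 1ₚ ⊕ gf (Paths lastEven)
  gf-Paths-lastOdd∘flip = begin
    gf (Paths (lastOdd ∘ flip))
      ≈⟨ gf-cong (accepts-∪ split start) ⟩
    gf (Paths lastNone ∪ Paths lastEven)
      ≈⟨ gf-∪ _ _ (accepts-disjoint disjoint start) ⟩
    gf (Paths lastNone) ⊕ gf (Paths lastEven)
      ≈⟨ ⊕-cong (≐-trans (gf-cong Paths-lastNone) gf-ε) (≐-refl {gf (Paths lastEven)}) ⟩
    1ₚ ⊕ gf (Paths lastEven) ∎
    where
    split : ∀ p → lastOdd (flip p) ≡ lastNone p ∨ lastEven p
    split none = refl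
    split odd  = refl
    split even = refl
    disjoint : ∀ p → lastNone p ∧ lastEven p ≡ false
    disjoint none = refl
    disjoint odd  = refl
    disjoint even = refl

  gf-Paths-lastEven∘flip : gf (Paths (lastEven ∘ flip)) ≐ gf (Paths lastOdd)
  gf-Paths-lastEven∘flip = gf-cong (accepts-cong lastEven∘flip≡lastOdd start)
    where
    lastEven∘flip≡lastOdd : ∀ p → lastEven (flip p) ≡ lastOdd p
    lastEven∘flip≡lastOdd none = refl
    lastEven∘flip≡lastOdd odd  = refl
    lastEven∘flip≡lastOdd even = refl

  gf-Paths-lastAny : gf (Paths lastAny) ≐ gf (Paths lastOdd) ⊕ gf (Paths lastEven)
  gf-Paths-lastAny = begin
    gf (Paths lastAny)                        ≈⟨ gf-cong (accepts-∪ split start) ⟩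
    gf (Paths lastOdd ∪ Paths lastEven)       ≈⟨ gf-∪ _ _ (accepts-disjoint disjoint start) ⟩
    gf (Paths lastOdd) ⊕ gf (Paths lastEven)  ∎
    where
    split : ∀ p → lastAny p ≡ lastOdd p ∨ lastEven p
    split none = refl
    split odd  = refl
    split even = refl
    disjoint : ∀ p → lastOdd p ∧ lastEven p ≡ false
    disjoint none = refl
    disjoint odd  = refl
    disjoint even = refl

  gf-Arches-lastOdd : gf (Arches lastOdd) ≐ X ⊛ X ⊛ (1ₚ ⊕ gf (Paths lastEven))
  gf-Arches-lastOdd = begin
    gf (Arches lastOdd)
      ≈⟨ gf-Arches lastOdd refl ⟩
    X ⊛ (gf (Paths (lastOdd ∘ flip)) ⊛ X)
      ≈⟨ ⊛-cong (≐-refl {X}) (⊛-cong gf-Paths-lastOdd∘flip (≐-refl {X})) ⟩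
    X ⊛ ((1ₚ ⊕ gf (Paths lastEven)) ⊛ X)
      ≈⟨ solve 2 (λ X E → X :* ((con 1ℚ :+ E) :* X) := X :* X :* (con 1ℚ :+ E))
             ≐-refl X (gf (Paths lastEven)) ⟩
    X ⊛ X ⊛ (1ₚ ⊕ gf (Paths lastEven)) ∎
    where open ℚ⟦X⟧-Solver using (solve; _:=_; _:+_; _:*_; con)

  gf-Arches-lastEven : gf (Arches lastEven) ≐ X ⊛ X ⊛ gf (Paths lastOdd)
  gf-Arches-lastEven = begin
    gf (Arches lastEven)
      ≈⟨ gf-Arches lastEven refl ⟩
    X ⊛ (gf (Paths (lastEven ∘ flip)) ⊛ X)
      ≈⟨ ⊛-cong (≐-refl {X}) (⊛-cong gf-Paths-lastEven∘flip (≐-refl {X})) ⟩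
    X ⊛ (gf (Paths lastOdd) ⊛ X)
      ≈⟨ solve 2 (λ X O → X :* (O :* X) := X :* X :* O) ≐-refl X (gf (Paths lastOdd)) ⟩
    X ⊛ X ⊛ gf (Paths lastOdd) ∎
    where open ℚ⟦X⟧-Solver using (solve; _:=_; _:*_)

open DescentAutomaton

module DyckSystem = ArchEquations (X ⊛ X) (gf (Paths lastOdd)) (gf (Paths lastEven)) (gf (Arches lastOdd))
  (gf (Arches lastEven)) (gf (Paths lastAny)) refl (gf-Paths lastOdd refl) (gf-Paths lastEven refl)
  gf-Arches-lastOdd gf-Arches-lastEven gf-Paths-lastAny

module DyckCount where

  open import Data.Rational using (_+_)
  import Data.Nat.Coprimality as Coprime
  open import Data.Nat.DivMod using (_/_; m/n≡1+[m∸n]/n)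

  parity : ℕ → Parity
  parity zero    = none
  parity (suc k) = if isOdd (suc k) then odd else even

  flip-parity : ∀ k → flip (parity k) ≡ parity (suc k)
  flip-parity zero    = refl
  flip-parity (suc k) with isOdd (suc k)
  ... | true  = refl
  ... | false = refl

  descentsAcc-suc-nonempty : ∀ k s → ∃₂ λ d ds → descentsAcc (suc k) s ≡ d ∷ ds
  descentsAcc-suc-nonempty k []      = _ , _ , refl
  descentsAcc-suc-nonempty k (D ∷ s) = descentsAcc-suc-nonempty (suc k) s
  descentsAcc-suc-nonempty k (U ∷ s) = _ , _ , refl

  descentsAcc-nonempty : ∀ h k s → validFrom (suc h) s ≡ true → ∃₂ λ d ds → descentsAcc k s ≡ d ∷ ds
  descentsAcc-nonempty h zero    (U ∷ s) valid = descentsAcc-nonempty (suc h) zero s valid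
  descentsAcc-nonempty h (suc k) (U ∷ s) valid = _ , _ , refl
  descentsAcc-nonempty h zero    (D ∷ s) valid = descentsAcc-suc-nonempty zero s
  descentsAcc-nonempty h (suc k) (D ∷ s) valid = descentsAcc-suc-nonempty (suc k) s

  allButLastOdd-cons : ∀ h x s →
    (validFrom (suc h) s ∧ allButLastOdd (x ∷ descentsAcc 0 s)) ≡
    isOdd x ∧ (validFrom (suc h) s ∧ allButLastOdd (descentsAcc 0 s))
  allButLastOdd-cons h x s with validFrom (suc h) s in valid
  ... | false = sym (BoolP.∧-zeroʳ (isOdd x))
  ... | true with descentsAcc-nonempty h 0 s valid
  ...   | d , ds , eq rewrite eq = refl

  -- Excludes the initial configuration, where the empty walk is valid but is not a path.
  Started : ℕ → ℕ → Set
  Started _       (suc _) = ⊤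
  Started (suc _) zero    = ⊤
  Started zero    zero    = ⊥

  -- Reading s at height h with k pending down-steps.
  validFrom∧allButLastOdd : ∀ s h k → Started h k →
    (validFrom h s ∧ allButLastOdd (descentsAcc k s)) ≡ accepts lastAny (at h (parity k)) s
  up-ends-descent : ∀ h k s →
    (validFrom (suc h) s ∧ allButLastOdd (suc k ∷ descentsAcc 0 s)) ≡
    accepts lastAny (up h (parity (suc k))) s

  validFrom∧allButLastOdd []      zero    (suc k) _ = lastAny-parity (isOdd (suc k))
    where
    lastAny-parity : ∀ b → true ≡ lastAny (if b then odd else even)
    lastAny-parity true  = refl
    lastAny-parity false = refl
  validFrom∧allButLastOdd []      (suc h) zero    _ = refl
  validFrom∧allButLastOdd []      (suc h) (suc k) _ = refl
  validFrom∧allButLastOdd (D ∷ s) zero    (suc k) _ = sym (accepts-dead lastAny s)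
  validFrom∧allButLastOdd (D ∷ s) (suc h) zero    _ = validFrom∧allButLastOdd s h 1 _
  validFrom∧allButLastOdd (D ∷ s) (suc h) (suc k) _ =
    trans (validFrom∧allButLastOdd s h (suc (suc k)) _)
          (cong (λ p → accepts lastAny (at h p) s) (sym (flip-parity (suc k))))
  validFrom∧allButLastOdd (U ∷ s) (suc h) zero    _ = validFrom∧allButLastOdd s (suc (suc h)) zero _
  validFrom∧allButLastOdd (U ∷ s) zero    (suc k) _ = up-ends-descent zero k s
  validFrom∧allButLastOdd (U ∷ s) (suc h) (suc k) _ = up-ends-descent (suc h) k s

  up-ends-descent h k s =
    trans (allButLastOdd-cons h (suc k) s)
          (trans (cong (isOdd (suc k) ∧_) (validFrom∧allButLastOdd s (suc h) zero _))
                 (up-parity (isOdd (suc k))))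
    where
    up-parity : ∀ b →
      b ∧ accepts lastAny (at (suc h) none) s ≡ accepts lastAny (up h (if b then odd else even)) s
    up-parity true  = refl
    up-parity false = sym (accepts-dead lastAny s)

  isDyck∧allButLastOdd : ∀ s → (isDyck s ∧ allButLastOdd (descents s)) ≡ Paths lastAny s
  isDyck∧allButLastOdd []      = refl
  isDyck∧allButLastOdd (U ∷ s) = validFrom∧allButLastOdd s 1 0 _
  isDyck∧allButLastOdd (D ∷ s) = sym (accepts-dead lastAny s)

  ℕ→ℚ-suc : ∀ n → ℕ→ℚ (suc n) ≡ 1ℚ + ℕ→ℚ n
  ℕ→ℚ-suc n = sym (trans (cong (1ℚ +_) ℕ→ℚ≡mkℚ) (cong (λ a → (ℤ.1ℤ ℤ.+ a) ℚ./ 1) (ℤP.*-identityʳ (ℤ.+ n))))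
    where
    ℕ→ℚ≡mkℚ : ℕ→ℚ n ≡ ℚ.mkℚ (ℤ.+ n) 0 (Coprime.sym (Coprime.1-coprimeTo n))
    ℕ→ℚ≡mkℚ = ℚP.normalize-coprime (Coprime.sym (Coprime.1-coprimeTo n))

  ℕ→ℚ-+ : ∀ a b → ℕ→ℚ (a ℕ.+ b) ≡ ℕ→ℚ a + ℕ→ℚ b
  ℕ→ℚ-+ zero    b = sym (ℚP.+-identityˡ (ℕ→ℚ b))
  ℕ→ℚ-+ (suc a) b = begin
    ℕ→ℚ (suc (a ℕ.+ b))         ≡⟨ ℕ→ℚ-suc (a ℕ.+ b) ⟩
    1ℚ + ℕ→ℚ (a ℕ.+ b)          ≡⟨ cong (1ℚ +_) (ℕ→ℚ-+ a b) ⟩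
    1ℚ + (ℕ→ℚ a + ℕ→ℚ b)        ≡⟨ ℚP.+-assoc 1ℚ (ℕ→ℚ a) (ℕ→ℚ b) ⟨
    1ℚ + ℕ→ℚ a + ℕ→ℚ b          ≡⟨ cong (_+ ℕ→ℚ b) (ℕ→ℚ-suc a) ⟨
    ℕ→ℚ (suc a) + ℕ→ℚ b         ∎
    where open ≡-Reasoning

  length-filterᵇ-map : ∀ (L : Lang) y ws → length (filterᵇ L (map (y ∷_) ws)) ≡ length (filterᵇ (∂ y L) ws)
  length-filterᵇ-map L y []       = refl
  length-filterᵇ-map L y (w ∷ ws) with L (y ∷ w)
  ... | true  = cong suc (length-filterᵇ-map L y ws)
  ... | false = length-filterᵇ-map L y ws

  length-filterᵇ-words : ∀ m L → ℕ→ℚ (length (filterᵇ L (words m))) ≡ gf L m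
  length-filterᵇ-words zero    L with L []
  ... | true  = refl
  ... | false = refl
  length-filterᵇ-words (suc m) L = begin
    ℕ→ℚ (length (filterᵇ L (map (U ∷_) (words m) ++ map (D ∷_) (words m))))
      ≡⟨ cong (ℕ→ℚ ∘ length) (ListP.filter-++ (T? ∘ L) (map (U ∷_) (words m)) (map (D ∷_) (words m))) ⟩
    ℕ→ℚ (length (filterᵇ L (map (U ∷_) (words m)) ++ filterᵇ L (map (D ∷_) (words m))))
      ≡⟨ cong ℕ→ℚ (ListP.length-++ (filterᵇ L (map (U ∷_) (words m)))) ⟩
    ℕ→ℚ (length (filterᵇ L (map (U ∷_) (words m))) ℕ.+ length (filterᵇ L (map (D ∷_) (words m))))
      ≡⟨ cong ℕ→ℚ (cong₂ ℕ._+_ (length-filterᵇ-map L U (words m)) (length-filterᵇ-map L D (words m))) ⟩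
    ℕ→ℚ (length (filterᵇ (∂ U L) (words m)) ℕ.+ length (filterᵇ (∂ D L) (words m)))
      ≡⟨ ℕ→ℚ-+ (length (filterᵇ (∂ U L) (words m))) (length (filterᵇ (∂ D L) (words m))) ⟩
    ℕ→ℚ (length (filterᵇ (∂ U L) (words m))) + ℕ→ℚ (length (filterᵇ (∂ D L) (words m)))
      ≡⟨ cong₂ _+_ (length-filterᵇ-words m (∂ U L)) (length-filterᵇ-words m (∂ D L)) ⟩
    gf L (suc m) ∎
    where open ≡-Reasoning

  accepts-length-parity : ∀ F s h p → accepts F (at h p) s ≡ true → isOdd (length s) ≡ isOdd h
  accepts-length-parity F []      zero    p _   = refl
  accepts-length-parity F []      (suc h) p ()
  accepts-length-parity F (U ∷ s) h       none acc =
    trans (cong not (accepts-length-parity F s (suc h) none acc)) (BoolP.not-involutive (isOdd h))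
  accepts-length-parity F (U ∷ s) h       odd  acc =
    trans (cong not (accepts-length-parity F s (suc h) none acc)) (BoolP.not-involutive (isOdd h))
  accepts-length-parity F (U ∷ s) h       even acc = ⊥-elim (true≢false (trans (sym acc) (accepts-dead F s)))
  accepts-length-parity F (D ∷ s) zero    p    acc = ⊥-elim (true≢false (trans (sym acc) (accepts-dead F s)))
  accepts-length-parity F (D ∷ s) (suc h) p    acc = cong not (accepts-length-parity F s h (flip p) acc)

  gf-no-words : ∀ m L → (∀ s → length s ≡ m → L s ≡ false) → gf L m ≡ 0ℚ
  gf-no-words zero    L no-words = cong indicator (no-words [] refl)
  gf-no-words (suc m) L no-words =
    cong₂ _+_ (gf-no-words m (∂ U L) (λ t |t|≡m → no-words (U ∷ t) (cong suc |t|≡m)))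
              (gf-no-words m (∂ D L) (λ t |t|≡m → no-words (D ∷ t) (cong suc |t|≡m)))

  gf-Paths-odd : ∀ F m → isOdd m ≡ true → gf (Paths F) m ≡ 0ℚ
  gf-Paths-odd F m m-odd = gf-no-words m (Paths F) λ s |s|≡m → BoolP.¬-not λ acc →
    true≢false (trans (sym m-odd) (trans (cong isOdd (sym |s|≡m)) (accepts-length-parity F s zero none acc)))

  half+half : ∀ i → isOdd i ≡ false → i / 2 ℕ.+ i / 2 ≡ i
  half+half zero          _      = refl
  half+half (suc (suc j)) j-even = begin
    suc (suc j) / 2 ℕ.+ suc (suc j) / 2
      ≡⟨ cong (λ a → a ℕ.+ a) (m/n≡1+[m∸n]/n {suc (suc j)} {2} (s≤s (s≤s z≤n))) ⟩
    suc (j / 2) ℕ.+ suc (j / 2)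
      ≡⟨ cong suc (ℕP.+-suc (j / 2) (j / 2)) ⟩
    suc (suc (j / 2 ℕ.+ j / 2))
      ≡⟨ cong (suc ∘ suc) (half+half j (trans (sym (BoolP.not-involutive (isOdd j))) j-even)) ⟩
    suc (suc j) ∎
    where open ≡-Reasoning

  gfCoeff≐gf : gfCoeff ≐ gf (Paths lastAny)
  gfCoeff≐gf i with isOdd i in i-parity
  ... | true  = sym (gf-Paths-odd lastAny i i-parity)
  ... | false = begin
    ℕ→ℚ (c (i / 2))
      ≡⟨ cong (λ n → ℕ→ℚ (length (filterᵇ DyckWithOddDescents (words n)))) (half+half i i-parity) ⟩
    ℕ→ℚ (length (filterᵇ DyckWithOddDescents (words i)))
      ≡⟨ length-filterᵇ-words i DyckWithOddDescents ⟩
    gf DyckWithOddDescents i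
      ≡⟨ gf-cong isDyck∧allButLastOdd i ⟩
    gf (Paths lastAny) i ∎
    where
    open ≡-Reasoning
    DyckWithOddDescents : Lang
    DyckWithOddDescents s = isDyck s ∧ allButLastOdd (descents s)

open DyckCount using (gfCoeff≐gf)

module _ where
  open ℚ⟦X⟧-Solver using (solve; _:=_; _:*_; _:+_; _:-_; _:^_)

  ⟦cubicExpr⟧ₚ-factor : ∀ Y w → ⟦ cubicExpr ⟧ₚ (X ⊛ Y) (Y ⊛ w) ≐ X ^ 4 ⊛ (Y ^ 6 ⊛ cubicₚ (X ⊛ X) w)
  ⟦cubicExpr⟧ₚ-factor Y w = solve 3 (λ X Y w →
    ⟦ cubicExpr ⟧ₛ X (X :* Y) (Y :* w) := X :^ 4 :* (Y :^ 6 :* cubicₛ (X :* X) w)) ≐-refl X Y w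

  ⟦denominatorExpr⟧ₚ-factor : ∀ Y w →
    ⟦ denominatorExpr ⟧ₚ (X ⊛ Y) (Y ⊛ w) ≐ Y ^ 2 ⊛ (w ⊛ w ⊕ ⊝ (X ⊛ X ⊛ (X ⊛ X)))
  ⟦denominatorExpr⟧ₚ-factor Y w = solve 3 (λ X Y w →
    ⟦ denominatorExpr ⟧ₛ X (X :* Y) (Y :* w) := Y :^ 2 :* (w :* w :- X :* X :* (X :* X))) ≐-refl X Y w

  cross-multiplied : ∀ Y w G → G ⊛ (w ⊛ w ⊕ ⊝ (X ⊛ X ⊛ (X ⊛ X))) ≐ X ⊛ X ⊛ (w ⊕ X ⊛ X) →
    (X ⊛ Y) ^ 1 ⊛ (G ⊛ ⟦ denominatorExpr ⟧ₚ (X ⊛ Y) (Y ⊛ w)) ≐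
    (X ⊛ Y) ^ 2 ⊛ ⟦ numeratorExpr ⟧ₚ (X ⊛ Y) (Y ⊛ w)
  cross-multiplied Y w G G-relation = begin
    (X ⊛ Y) ^ 1 ⊛ (G ⊛ ⟦ denominatorExpr ⟧ₚ (X ⊛ Y) (Y ⊛ w))
      ≈⟨ solve 4 (λ X Y w G → (X :* Y) :^ 1 :* (G :* ⟦ denominatorExpr ⟧ₛ X (X :* Y) (Y :* w))
                                := X :* Y :^ 3 :* (G :* (w :* w :- X :* X :* (X :* X)))) ≐-refl X Y w G ⟩
    X ⊛ Y ^ 3 ⊛ (G ⊛ (w ⊛ w ⊕ ⊝ (X ⊛ X ⊛ (X ⊛ X))))
      ≈⟨ ⊛-cong (≐-refl {X ⊛ Y ^ 3}) G-relation ⟩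
    X ⊛ Y ^ 3 ⊛ (X ⊛ X ⊛ (w ⊕ X ⊛ X))
      ≈⟨ solve 3 (λ X Y w → X :* Y :^ 3 :* (X :* X :* (w :+ X :* X))
                              := (X :* Y) :^ 2 :* ⟦ numeratorExpr ⟧ₛ X (X :* Y) (Y :* w)) ≐-refl X Y w ⟩
    (X ⊛ Y) ^ 2 ⊛ ⟦ numeratorExpr ⟧ₚ (X ⊛ Y) (Y ⊛ w) ∎
    where open import Relation.Binary.Reasoning.Setoid setoid

module Root (k : ℕ) (f : PS) (no-pole : ∀ n → coeff (suc k ⸴ f) -[1+ suc n ] ≡ 0ℚ)
  (residue : coeff (suc k ⸴ f) -[1+ 0 ] ≡ 1ℚ) where

  open import Relation.Binary.Reasoning.Setoid setoid

  v : Laurent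
  v = suc k ⸴ f

  -- f starts with k zeros and then 1, so v = z⁻¹ w with w 0 = 1.
  w : PS
  w i = f (k ℕ.+ i)

  w₀≡1 : w 0 ≡ 1ℚ
  w₀≡1 = trans (cong f (ℕP.+-identityʳ k))
               (trans (sym (coeff-at (suc k) f -[1+ 0 ] (+⊖-cancelʳ 1 k))) residue)

  cf-⟦⟧-factored : ∀ e → cf (⟦ e ⟧ v) ≐ ⟦ e ⟧ₚ (X ^ suc k) (X ^ k ⊛ w)
  cf-⟦⟧-factored e = ≐-trans (cf-⟦⟧ e (suc k) f) (⟦⟧ₚ-cong e (X ^ suc k) (pole-factor 1 k f no-pole))

  cubic-w : cubic v ≈L 0L → cubicₚ (X ⊛ X) w ≐ 0ₚ
  cubic-w cubic≈0 = [X^k]^n⊛-cancel-zero k 6 _ (X^⊛-cancel-zero 4 _ (begin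
    X ^ 4 ⊛ ((X ^ k) ^ 6 ⊛ cubicₚ (X ⊛ X) w)  ≈⟨ ⟦cubicExpr⟧ₚ-factor (X ^ k) w ⟨
    ⟦ cubicExpr ⟧ₚ (X ^ suc k) (X ^ k ⊛ w)    ≈⟨ cf-⟦⟧-factored cubicExpr ⟨
    cf (cubic v)                              ≈⟨ cf≐0ₚ cubic≈0 ⟩
    0ₚ                                        ∎))

  denominator≉0 : ¬ (⟦ denominatorExpr ⟧ v ≈L 0L)
  denominator≉0 den≈0 = ℚP.1≢0 (trans (sym w²-x²₀≡1) (w²-x²≐0 0))
    where
    w²-x²≐0 : w ⊛ w ⊕ ⊝ (X ⊛ X ⊛ (X ⊛ X)) ≐ 0ₚ
    w²-x²≐0 = [X^k]^n⊛-cancel-zero k 2 _ (begin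
      (X ^ k) ^ 2 ⊛ (w ⊛ w ⊕ ⊝ (X ⊛ X ⊛ (X ⊛ X)))  ≈⟨ ⟦denominatorExpr⟧ₚ-factor (X ^ k) w ⟨
      ⟦ denominatorExpr ⟧ₚ (X ^ suc k) (X ^ k ⊛ w)  ≈⟨ cf-⟦⟧-factored denominatorExpr ⟨
      cf (⟦ denominatorExpr ⟧ v)                    ≈⟨ cf≐0ₚ den≈0 ⟩
      0ₚ                                            ∎)
    w²-x²₀≡1 : (w ⊛ w ⊕ ⊝ (X ⊛ X ⊛ (X ⊛ X))) 0 ≡ 1ℚ
    w²-x²₀≡1 = cong (λ a → a ℚ.* a ℚ.+ ℚ.- 0ℚ) w₀≡1

  quotient : cubic v ≈L 0L → GF *L ⟦ denominatorExpr ⟧ v ≈L ⟦ numeratorExpr ⟧ v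
  quotient cubic≈0 = ≈L-cross (begin
    X ^ ord (⟦ numeratorExpr ⟧ v) ⊛ mulPS gfCoeff (cf (⟦ denominatorExpr ⟧ v))
      ≈⟨ ⊛-cong (X^ord-⟦⟧ numeratorExpr (suc k) f)
                (≐-trans (mulPS≐⊛ gfCoeff _) (⊛-cong gfCoeff≐gf (cf-⟦⟧-factored denominatorExpr))) ⟩
    (X ^ suc k) ^ 1 ⊛ (gf (Paths lastAny) ⊛ ⟦ denominatorExpr ⟧ₚ (X ^ suc k) (X ^ k ⊛ w))
      ≈⟨ cross-multiplied (X ^ k) w (gf (Paths lastAny))
           (DyckSystem.G⊛[u²-x²]≐x⊛[u+x] w (cubic-w cubic≈0) w₀≡1) ⟩
    (X ^ suc k) ^ 2 ⊛ ⟦ numeratorExpr ⟧ₚ (X ^ suc k) (X ^ k ⊛ w)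
      ≈⟨ ⊛-cong (X^ord-⟦⟧ denominatorExpr (suc k) f) (cf-⟦⟧-factored numeratorExpr) ⟨
    X ^ ord (⟦ denominatorExpr ⟧ v) ⊛ cf (⟦ numeratorExpr ⟧ v) ∎)

mainTheorem3 : (v₁ : Laurent) → cubic v₁ ≈L 0L → HasForm v₁ →
    IsQuotient GF (zL *L v₁ +L zpow 2) (v₁ *L v₁ -L zpow 2)
    × (c 1 ≡ 1 × c 2 ≡ 2 × c 3 ≡ 4 × c 4 ≡ 9 × c 5 ≡ 22 × c 6 ≡ 56 × c 7 ≡ 147)
-- With ord v₁ = 0 the coefficient of z⁻¹ is 0 by definition, contradicting HasForm.
mainTheorem3 (zero  ⸴ f) _        (_       , residue , _) = ⊥-elim (ℚP.1≢0 (sym residue))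
mainTheorem3 (suc k ⸴ f) cubic≈0 (no-pole , residue , _) =
  (denominator≉0 , quotient cubic≈0) , refl , refl , refl , refl , refl , refl , refl
  where open Root k f no-pole residue
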